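{- Let $H$ be a graph with at least one edge. Then: (i) if $H$ contains a pendant edge and $n>f(H)+1$, then $\mathrm{rwsat}(n, H)\leq \binom{f(H)+1}{2}$; (ii) if $H$ contains no pendant edges and $n>f(H)+\delta'(H)$, then $$\frac{1}{2}\delta'(H)n \leq\mathrm{rwsat}(n, H)\leq \delta'(H)\bigl(n-f(H)-\delta'(H)\bigr)+\binom{f(H)+\delta'(H)}{2}.$$
   Context: All graphs are finite and simple. An edge is pendant if one of its endpoints has degree $1$. $\delta'(H)=\min\{d_H(v)\colon v\in V(H),\ d_H(v)\neq 0\}$. For a family $\mathscr{F}$ of graphs, $\mathrm{ex}(N,\mathscr{F})$ is the maximum number of edges in an $N$-vertex graph containing no member of $\mathscr{F}$ as a subgraph. For a graph $H$, let $\mathscr{H}=\{H-\{x,y\}\colon xy\in E(H)\}$ (deleting the two vertices $x,y$), and let $f(H)$ be the smallest integer $n$ such that for each $N\in\{n-1,n\}$ we have $\mathrm{ex}(N,\mathscr{H})\leq \binom{N}{2}-2N-2$. An edge-coloring of $G$ is a map $c\colon E(G)\to\mathbb{N}$; a subgraph is rainbow if its edges have pairwise distinct colors. An edge-colored graph $G$ is weakly $H$-rainbow saturated if there exists an ordering $e_1,\dots,e_m$ of the non-edges of $G$ such that for every list $c_1,\dots,c_m$ of pairwise distinct colors from $\mathbb{N}$ (possibly coinciding with colors used on $G$), for every $i\in[m]$ the edge-colored graph obtained from $G$ by adding $e_1,\dots,e_i$ with $e_k$ colored $c_k$ contains a rainbow copy of $H$ containing $e_i$ ($G$ need not be rainbow-$H$-free).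 $\mathrm{rwsat}(n,H)$ is the minimum number of edges of such a graph on $n$ vertices (defined as $\binom n2$ if none exists). -}

module Defs where

open import Data.Nat using (ℕ; zero; suc; _+_; _*_; _∸_; _≤_; _<_; _<ᵇ_)
open import Data.Nat.Combinatorics using (_C_)
open import Data.Bool using (Bool; true; false; _∧_; _∨_; if_then_else_)
open import Data.Fin using (Fin; toℕ; _≟_)
open import Data.List using (List; []; _∷_; length; filterᵇ; cartesianProduct; allFin; zip; take; lookup; foldl)
open import Data.List.Membership.Propositional using (_∈_)
open import Data.List.Relation.Unary.Unique.Propositional using (Unique)
open import Data.Product using (Σ; Σ-syntax; ∃; ∃-syntax; _×_; _,_; proj₁; proj₂)
open import Data.Sum using (_⊎_)
open import Relation.Nullary using (¬_; ⌊_⌋)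
open import Relation.Binary.PropositionalEquality using (_≡_; _≢_)

record Graph (n : ℕ) : Set where
  field
    adj    : Fin n → Fin n → Bool
    sym    : ∀ u v → adj u v ≡ adj v u
    irrefl : ∀ u → adj u u ≡ false
open Graph public

eCount : ∀ {n} → Graph n → ℕ
eCount {n} G = length (filterᵇ (λ p → (toℕ (proj₁ p) <ᵇ toℕ (proj₂ p)) ∧ adj G (proj₁ p) (proj₂ p))
                                (cartesianProduct (allFin n) (allFin n)))

deg : ∀ {n} → Graph n → Fin n → ℕ
deg {n} G v = length (filterᵇ (adj G v) (allFin n))

HasEdge : ∀ {k} → Graph k → Set
HasEdge H = ∃[ u ] ∃[ v ] adj H u v ≡ true

HasPendant : ∀ {k} → Graph k → Set
HasPendant H = ∃[ u ] ∃[ v ] (adj H u v ≡ true × (deg H u ≡ 1 ⊎ deg H v ≡ 1))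

IsMinPosDeg : ∀ {k} → Graph k → ℕ → Set
IsMinPosDeg H d = (∃[ v ] (deg H v ≡ d)) × (d ≢ 0) × (∀ v → deg H v ≢ 0 → d ≤ deg H v)

-- The family ℋ = { H - {x,y} : xy ∈ E(H) } and f(H)

CopyOfDel : ∀ {k N} → Graph k → Fin k → Fin k → Graph N → Set
CopyOfDel {k} {N} H x y G =
  Σ[ φ ∈ ((u : Fin k) → u ≢ x → u ≢ y → Fin N) ]
    ((∀ u v (ux : u ≢ x) (uy : u ≢ y) (vx : v ≢ x) (vy : v ≢ y) →
        φ u ux uy ≡ φ v vx vy → u ≡ v)
    × (∀ u v (ux : u ≢ x) (uy : u ≢ y) (vx : v ≢ x) (vy : v ≢ y) →
        adj H u v ≡ true → adj G (φ u ux uy) (φ v vx vy) ≡ true))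

ContainsFamily : ∀ {k N} → Graph k → Graph N → Set
ContainsFamily H G = ∃[ x ] ∃[ y ] (adj H x y ≡ true × CopyOfDel H x y G)

-- ex(N, ℋ) ≤ B, unfolded: every ℋ-free N-vertex graph has at most B edges
ExAtMost : ∀ {k} → Graph k → ℕ → ℕ → Set
ExAtMost H N B = (G : Graph N) → ¬ ContainsFamily H G → eCount G ≤ B

-- the defining property of f(H) for a candidate n:
-- for each N ∈ {n-1, n} (N ranging over ℕ), ex(N,ℋ) ≤ C(N,2) - 2N - 2,
-- written additively as ex(N,ℋ) + 2N + 2 ≤ C(N,2) (the right side may be negative)
FProp : ∀ {k} → Graph k → ℕ → Set
FProp H n = ∀ N → (N ≡ n ⊎ suc N ≡ n) →
  ∀ e → ExAtMost H N e → (∀ e' → ExAtMost H N e' → e ≤ e') → e + 2 * N + 2 ≤ N C 2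

IsF : ∀ {k} → Graph k → ℕ → Set
IsF H f = FProp H f × (∀ m → m < f → ¬ FProp H m)

record ColGraph (n : ℕ) : Set where
  field
    graph  : Graph n
    col    : Fin n → Fin n → ℕ         -- colour of edge uv (only used on edges)
    colSym : ∀ u v → col u v ≡ col v u
open ColGraph public

-- raw adjacency + colouring (used for G + e₁ + … + eᵢ)
Adj : ℕ → Set
Adj n = Fin n → Fin n → Bool

Col : ℕ → Set
Col n = Fin n → Fin n → ℕ

samePair : ∀ {n} → Fin n × Fin n → Fin n → Fin n → Bool
samePair (a , b) u v = (⌊ a ≟ u ⌋ ∧ ⌊ b ≟ v ⌋) ∨ (⌊ a ≟ v ⌋ ∧ ⌊ b ≟ u ⌋)

addEdge : ∀ {n} → Adj n × Col n → (Fin n × Fin n) × ℕ → Adj n × Col n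
addEdge (A , C) (e , c) =
  (λ u v → samePair e u v ∨ A u v) ,
  (λ u v → if samePair e u v then c else C u v)

addEdges : ∀ {n} → Adj n × Col n → List ((Fin n × Fin n) × ℕ) → Adj n × Col n
addEdges = foldl addEdge

SameEdge : ∀ {k} → Fin k → Fin k → Fin k → Fin k → Set
SameEdge u v u' v' = (u ≡ u' × v ≡ v') ⊎ (u ≡ v' × v ≡ u')

RainbowCopyContaining : ∀ {k n} → Graph k → Adj n × Col n → Fin n × Fin n → Set
RainbowCopyContaining {k} {n} H (A , C) (a , b) =
  Σ[ φ ∈ (Fin k → Fin n) ]
    ((∀ u v → φ u ≡ φ v → u ≡ v)
    × (∀ u v → adj H u v ≡ true → A (φ u) (φ v) ≡ true)
    × (∀ u v u' v' → adj H u v ≡ true → adj H u' v' ≡ true → ¬ SameEdge u v u' v' →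
         C (φ u) (φ v) ≢ C (φ u') (φ v'))
    × (∃[ u ] ∃[ v ] (adj H u v ≡ true × φ u ≡ a × φ v ≡ b)))

NonEdgeOrdering : ∀ {n} → Graph n → List (Fin n × Fin n) → Set
NonEdgeOrdering G L =
  Unique L ×
  (∀ u v → ((u , v) ∈ L → (toℕ u < toℕ v × adj G u v ≡ false))
         × ((toℕ u < toℕ v × adj G u v ≡ false) → (u , v) ∈ L))

WeaklyRainbowSat : ∀ {k n} → Graph k → ColGraph n → Set
WeaklyRainbowSat H G =
  Σ[ L ∈ List _ ] (NonEdgeOrdering (graph G) L ×
    ((cs : List ℕ) → length cs ≡ length L → Unique cs →
      (i : Fin (length L)) →
        RainbowCopyContaining H
          (addEdges (adj (graph G) , col G) (take (suc (toℕ i)) (zip L cs)))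
          (lookup L i)))

IsRwsat : ∀ {k} → ℕ → Graph k → ℕ → Set
IsRwsat n H r =
  (Σ[ G ∈ ColGraph n ] (WeaklyRainbowSat H G × eCount (graph G) ≡ r
      × (∀ (G' : ColGraph n) → WeaklyRainbowSat H G' → r ≤ eCount (graph G'))))
  ⊎ (((G : ColGraph n) → ¬ WeaklyRainbowSat H G) × r ≡ n C 2)

module Submission where

-- Let S be the first s vertices and T ⊆ S the first t; make S a clique, join T to
-- everything, and give every edge its own colour. The missing pairs are added in two phases. A
-- pair ab with a ∈ S ∖ T and b ∉ S completes a rainbow copy of H in which an edge zx, with z of
-- degree at most max(t, 1), is mapped to ba and all other vertices go into S (the neighbours of z
-- into T). A pair ab outside S completes a copy because the f vertices of S ∖ T still span more
-- than ex(f, ℋ) edges whose colours avoid those of the new edges at a and b, hence contain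
-- H − {x, y} for an edge xy, which is then mapped to ab. Taking s = f + 1, t = 0 when H has a
-- pendant edge and s = f + δ′, t = δ′ otherwise gives the two upper bounds.
--
-- In a weakly saturated graph every vertex v has degree at least δ′: otherwise colour
-- the first added pair vω at v like an existing edge vq (earlier pairs, none at v, get fresh
-- colours); a rainbow copy through vω sends a vertex of degree ≥ δ′ to v, and its neighbours would
-- have to land injectively in N(v) ∪ {ω} ∖ {q}. Summing degrees gives δ′ n ≤ 2 r.

open import Data.Bool using (Bool; true; false; not; _∧_; _∨_; if_then_else_; T; T?)
import Data.Bool.Properties as Bool
open import Data.Bool.Properties using (∧-zeroʳ; ∧-identityʳ; ∧-comm; ∨-comm; ∧-conicalˡ; ∧-conicalʳ; not-¬; ¬-not)
open import Data.Empty using (⊥)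
open import Data.Fin using (Fin; zero; suc; toℕ; fromℕ<)
open import Data.Fin.Properties using (_≟_; toℕ-injective; toℕ<n; toℕ-fromℕ<; any?; all?; injective⇒≤)
open import Data.List using (List; []; _∷_; _++_; [_]; length; filter; filterᵇ; tabulate; map; cartesianProduct; allFin; zip; take; lookup; applyUpTo)
open import Data.List.Properties using (length-++; filter-++; map-tabulate; length-take; length-tabulate; length-map; length-applyUpTo; foldl-++)
open import Data.List.Membership.Propositional using (_∈_; find; lose)
open import Data.List.Membership.Propositional.Properties using (∈-filter⁺; ∈-filter⁻; ∈-allFin; ∈-lookup; ∈-++⁻; ∈-++⁺ˡ; ∈-++⁺ʳ; ∈-cartesianProduct⁺; ∈-map⁺; ∈-applyUpTo⁻; ∈-length)
open import Data.List.Relation.Unary.All as All using (All; []; _∷_)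
open import Data.List.Relation.Unary.All.Properties using (¬Any⇒All¬; All¬⇒¬Any)
open import Data.List.Relation.Unary.AllPairs using (_∷_)
open import Data.List.Relation.Unary.Any as Any using (Any; here; there; index)
open import Data.List.Relation.Unary.Any.Properties using (lookup-index)
import Data.List.Relation.Unary.First as First
open import Data.List.Relation.Unary.First.Properties using (toView)
open import Data.List.Relation.Unary.Unique.Propositional using (Unique)
open import Data.List.Relation.Unary.Unique.Propositional.Properties using (++⁺; filter⁺; take⁺; allFin⁺; cartesianProduct⁺; applyUpTo⁺₁)
open import Data.Nat using (ℕ; zero; suc; NonZero; _+_; _*_; _∸_; _≤_; _<_; z≤n; s≤s; _<?_; _≤?_; _<ᵇ_; _⊓_; _⊔_; _/_; _%_)
import Data.Nat as ℕ
open import Data.List.Membership.DecPropositional ℕ._≟_ using (_∈?_; _∉_)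
open import Data.Nat.Combinatorics using (_C_; nCk+nC[k+1]≡[n+1]C[k+1]; nC1≡n)
open import Data.Nat.DivMod using ([m+kn]%n≡m%n; m<n⇒m%n≡m; +-distrib-/-∣ʳ; m<n⇒m/n≡0; m*n/n≡m)
open import Data.Nat.Divisibility using (divides-refl)
open import Data.Nat.Induction using (<-rec)
open import Data.Nat.Properties hiding (_≟_)
open import Algebra.Properties.Semiring.Sum +-*-semiring using (sum; sum-syntax; ∑-distrib-+; ∑-comm; sum-cong-≗; sum-replicate-zero; *-distribˡ-sum; *-distribʳ-sum)
open import Data.Nat.Tactic.RingSolver using (solve-∀)
open import Data.Product using (Σ-syntax; _×_; _,_; proj₁; proj₂; ∃; ∃-syntax)
open import Data.Sum using (_⊎_; inj₁; inj₂)
import Data.Sum as Sum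
open import Data.Unit using (⊤; tt)
import Data.Vec.Functional as Vector
open import Data.Vec.Functional.Properties using (∷-cong)
open import Function using (_∘_; id)
open import Level using (0ℓ)
open import Relation.Binary using (tri<; tri≈; tri>)
open import Relation.Binary.PropositionalEquality using (_≡_; _≢_; _≗_; refl; sym; trans; cong; cong₂; subst; subst₂; module ≡-Reasoning)
open import Relation.Nullary using (Dec; yes; no; does; ⌊_⌋; ¬_; ¬?; contradiction; _×-dec_; _⊎-dec_; _→-dec_)
open import Relation.Nullary.Decidable using (dec-true; dec-false; decidable-stable; toSum)
open import Relation.Unary using (Pred; Decidable)

open import Defs renaming (sym to adj-sym)

private
  variable
    A B : Set
    k m n r N : ℕ
    x x′ : A
    y : B
    xs xs₁ xs₂ : List A
    ys ys₁ ys₂ : List B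

-- Counting with indicator sums

𝟙 : Bool → ℕ
𝟙 true  = 1
𝟙 false = 0

count : {P : Pred (Fin n) 0ℓ} → Decidable P → ℕ
count {n} P? = ∑[ i < n ] 𝟙 (does (P? i))

∑-mono-≤ : {f g : Fin n → ℕ} → (∀ i → f i ≤ g i) → sum f ≤ sum g
∑-mono-≤ {zero}  f≤g = z≤n
∑-mono-≤ {suc n} f≤g = +-mono-≤ (f≤g zero) (∑-mono-≤ (f≤g ∘ suc))

∑-const : ∀ n c → ∑[ i < n ] c ≡ n * c
∑-const zero    c = refl
∑-const (suc n) c = cong (c +_) (∑-const n c)

length-filter-tabulate : {P : Pred A 0ℓ} (P? : Decidable P) (f : Fin n → A) →
  length (filter P? (tabulate f)) ≡ ∑[ i < n ] 𝟙 (does (P? (f i)))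
length-filter-tabulate {n = zero}  P? f = refl
length-filter-tabulate {n = suc n} P? f with does (P? (f zero))
... | true  = cong suc (length-filter-tabulate P? (f ∘ suc))
... | false = length-filter-tabulate P? (f ∘ suc)

length-filter-cartesianProduct : {P : Pred (A × B) 0ℓ} (P? : Decidable P) (f : Fin n → A) (g : Fin m → B) →
  length (filter P? (cartesianProduct (tabulate f) (tabulate g))) ≡ ∑[ i < n ] ∑[ j < m ] 𝟙 (does (P? (f i , g j)))
length-filter-cartesianProduct {n = zero}  P? f g = refl
length-filter-cartesianProduct {n = suc n} P? f g = begin
  length (filter P? (map (f zero ,_) (tabulate g) ++ rest))
    ≡⟨ cong length (filter-++ P? (map (f zero ,_) (tabulate g)) rest) ⟩
  length (filter P? (map (f zero ,_) (tabulate g)) ++ filter P? rest)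
    ≡⟨ length-++ (filter P? (map (f zero ,_) (tabulate g))) ⟩
  length (filter P? (map (f zero ,_) (tabulate g))) + length (filter P? rest)
    ≡⟨ cong₂ _+_ (trans (cong (length ∘ filter P?) (map-tabulate g (f zero ,_))) (length-filter-tabulate P? ((f zero ,_) ∘ g)))
                 (length-filter-cartesianProduct P? (f ∘ suc) g) ⟩
  _ ∎
  where
  open ≡-Reasoning
  rest = cartesianProduct (tabulate (f ∘ suc)) (tabulate g)

𝟙≤1 : ∀ b → 𝟙 b ≤ 1
𝟙≤1 true  = ≤-refl
𝟙≤1 false = z≤n

𝟙-∧-≤ˡ : ∀ a b → 𝟙 (a ∧ b) ≤ 𝟙 a
𝟙-∧-≤ˡ true  b = 𝟙≤1 b
𝟙-∧-≤ˡ false b = z≤n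

count-∪ : {P Q R : Pred (Fin n) 0ℓ} (P? : Decidable P) (Q? : Decidable Q) (R? : Decidable R) →
  (∀ {i} → P i → Q i ⊎ R i) → count P? ≤ count Q? + count R?
count-∪ P? Q? R? P⊆Q∪R = ≤-trans (∑-mono-≤ pointwise) (≤-reflexive (∑-distrib-+ (λ i → 𝟙 (does (Q? i))) (λ i → 𝟙 (does (R? i)))))
  where
  pointwise : ∀ i → 𝟙 (does (P? i)) ≤ 𝟙 (does (Q? i)) + 𝟙 (does (R? i))
  pointwise i with P? i
  ... | no _ = z≤n
  ... | yes p with P⊆Q∪R p
  ...   | inj₁ q rewrite dec-true (Q? i) q = s≤s z≤n
  ...   | inj₂ r rewrite dec-true (R? i) r = m≤n+m 1 _

count-complement : {P : Pred (Fin n) 0ℓ} (P? : Decidable P) → count P? + count (¬? ∘ P?) ≡ n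
count-complement {n} P? = begin
  count P? + count (¬? ∘ P?)             ≡⟨ ∑-distrib-+ (λ i → 𝟙 (does (P? i))) (λ i → 𝟙 (not (does (P? i)))) ⟨
  ∑[ i < n ] (𝟙 (does (P? i)) + 𝟙 (not (does (P? i))))  ≡⟨ sum-cong-≗ (λ i → pointwise (does (P? i))) ⟩
  ∑[ i < n ] 1                           ≡⟨ ∑-const n 1 ⟩
  n * 1                                  ≡⟨ *-identityʳ n ⟩
  n                                      ∎
  where
  open ≡-Reasoning
  pointwise : ∀ b → 𝟙 b + 𝟙 (not b) ≡ 1
  pointwise true  = refl
  pointwise false = refl

count-< : ∀ {n} s → s ≤ n → count (λ (i : Fin n) → toℕ i <? s) ≡ s
count-< {n} zero    _         = sum-replicate-zero n
count-< (suc s) (s≤s s≤n) = cong suc (count-< s s≤n)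

count-pairs : ∀ {n} s → s ≤ n →
  ∑[ u < n ] ∑[ v < n ] 𝟙 (does (toℕ u <? toℕ v) ∧ does (toℕ v <? s)) ≡ s C 2
count-pairs {n} zero _ = trans (sum-cong-≗ none) (sum-replicate-zero n)
  where
  none : ∀ (u : Fin n) → ∑[ v < n ] 𝟙 (does (toℕ u <? toℕ v) ∧ false) ≡ 0
  none u = trans (sum-cong-≗ {n} (λ v → cong 𝟙 (∧-zeroʳ (does (toℕ u <? toℕ v))))) (sum-replicate-zero n)
count-pairs {suc n} (suc s) (s≤s s≤n) = begin
  count (λ (v : Fin n) → toℕ v <? s) + ∑[ u < n ] ∑[ v < n ] 𝟙 (does (toℕ u <? toℕ v) ∧ does (toℕ v <? s))
    ≡⟨ cong₂ _+_ (count-< s s≤n) (count-pairs s s≤n) ⟩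
  s + s C 2                         ≡⟨ cong (_+ s C 2) (nC1≡n s) ⟨
  s C 1 + s C 2                     ≡⟨ nCk+nC[k+1]≡[n+1]C[k+1] s 1 ⟩
  suc s C 2                         ∎
  where
  open ≡-Reasoning

deg≡∑ : (G : Graph n) (v : Fin n) → deg G v ≡ ∑[ w < n ] 𝟙 (adj G v w)
deg≡∑ G v = length-filter-tabulate (T? ∘ adj G v) id

eCount≡∑ : (G : Graph n) → eCount G ≡ ∑[ u < n ] ∑[ v < n ] 𝟙 ((toℕ u <ᵇ toℕ v) ∧ adj G u v)
eCount≡∑ G = length-filter-cartesianProduct (λ (u , v) → T? ((toℕ u <ᵇ toℕ v) ∧ adj G u v)) id id

handshake : (G : Graph n) → ∑[ v < n ] deg G v ≡ 2 * eCount G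
handshake {n} G = begin
  ∑[ u < n ] deg G u                                   ≡⟨ sum-cong-≗ (deg≡∑ G) ⟩
  ∑[ u < n ] ∑[ v < n ] 𝟙 (adj G u v)
    ≡⟨ sum-cong-≗ (λ u → trans (sum-cong-≗ (split u)) (∑-distrib-+ (forward u) (backward u))) ⟩
  ∑[ u < n ] (sum (forward u) + sum (backward u))      ≡⟨ ∑-distrib-+ (sum ∘ forward) (sum ∘ backward) ⟩
  E + ∑[ u < n ] ∑[ v < n ] backward u v               ≡⟨ cong (E +_) (∑-comm backward) ⟩
  E + ∑[ v < n ] ∑[ u < n ] backward u v
    ≡⟨ cong (E +_) (sum-cong-≗ (λ v → sum-cong-≗ (λ u → cong (λ b → 𝟙 ((toℕ v <ᵇ toℕ u) ∧ b)) (adj-sym G u v)))) ⟩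
  E + E                                                ≡⟨ cong (E +_) (+-identityʳ E) ⟨
  2 * E                                                ≡⟨ cong (2 *_) (eCount≡∑ G) ⟨
  2 * eCount G                                         ∎
  where
  open ≡-Reasoning
  forward backward : Fin n → Fin n → ℕ
  forward  u v = 𝟙 ((toℕ u <ᵇ toℕ v) ∧ adj G u v)
  backward u v = 𝟙 ((toℕ v <ᵇ toℕ u) ∧ adj G u v)
  E = ∑[ u < n ] ∑[ v < n ] forward u v
  split : ∀ u v → 𝟙 (adj G u v) ≡ forward u v + backward u v
  split u v with <-cmp (toℕ u) (toℕ v)
  ... | tri< u<v _ v≮u rewrite dec-true (toℕ u <? toℕ v) u<v | dec-false (toℕ v <? toℕ u) v≮u = sym (+-identityʳ _)
  ... | tri> u≮v _ v<u rewrite dec-false (toℕ u <? toℕ v) u≮v | dec-true (toℕ v <? toℕ u) v<u = refl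
  ... | tri≈ u≮v u≡v v≮u rewrite dec-false (toℕ u <? toℕ v) u≮v | dec-false (toℕ v <? toℕ u) v≮u
                               | toℕ-injective u≡v | irrefl G v = refl

eCount≤C2 : (G : Graph n) → eCount G ≤ n C 2
eCount≤C2 {n} G = begin
  eCount G                                                          ≡⟨ eCount≡∑ G ⟩
  ∑[ u < n ] ∑[ v < n ] 𝟙 ((toℕ u <ᵇ toℕ v) ∧ adj G u v)            ≤⟨ ∑-mono-≤ (λ u → ∑-mono-≤ (bound u)) ⟩
  ∑[ u < n ] ∑[ v < n ] 𝟙 ((toℕ u <ᵇ toℕ v) ∧ (toℕ v <ᵇ n))         ≡⟨ count-pairs n ≤-refl ⟩
  n C 2                                                             ∎
  where
  open ≤-Reasoning
  bound : ∀ u v → 𝟙 ((toℕ u <ᵇ toℕ v) ∧ adj G u v) ≤ 𝟙 ((toℕ u <ᵇ toℕ v) ∧ (toℕ v <ᵇ n))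
  bound u v rewrite dec-true (toℕ v <? n) (toℕ<n v) | ∧-identityʳ (toℕ u <ᵇ toℕ v) = 𝟙-∧-≤ˡ _ _

≟-sym : (u v : Fin n) → does (u ≟ v) ≡ does (v ≟ u)
≟-sym u v with u ≟ v | v ≟ u
... | yes _   | yes _   = refl
... | no _    | no _    = refl
... | yes u≡v | no v≢u  = contradiction (sym u≡v) v≢u
... | no u≢v  | yes v≡u = contradiction (sym v≡u) u≢v

K : ∀ n → Graph n
K n = record
  { adj    = λ u v → not (does (u ≟ v))
  ; sym    = λ u v → cong not (≟-sym u v)
  ; irrefl = λ u → cong not (dec-true (u ≟ u) refl)
  }

eCount-K : ∀ n → eCount (K n) ≡ n C 2
eCount-K n = begin
  eCount (K n)                                                       ≡⟨ eCount≡∑ (K n) ⟩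
  ∑[ u < n ] ∑[ v < n ] 𝟙 ((toℕ u <ᵇ toℕ v) ∧ not (does (u ≟ v)))  ≡⟨ sum-cong-≗ (λ u → sum-cong-≗ (pointwise u)) ⟩
  ∑[ u < n ] ∑[ v < n ] 𝟙 ((toℕ u <ᵇ toℕ v) ∧ (toℕ v <ᵇ n))          ≡⟨ count-pairs n ≤-refl ⟩
  n C 2                                                              ∎
  where
  open ≡-Reasoning
  pointwise : ∀ u v → 𝟙 ((toℕ u <ᵇ toℕ v) ∧ not (does (u ≟ v))) ≡ 𝟙 ((toℕ u <ᵇ toℕ v) ∧ (toℕ v <ᵇ n))
  pointwise u v with toℕ u <? toℕ v
  ... | no u≮v  rewrite dec-false (toℕ u <? toℕ v) u≮v = refl
  ... | yes u<v rewrite dec-true (toℕ u <? toℕ v) u<v | dec-false (u ≟ v) (<⇒≢ u<v ∘ cong toℕ)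
                      | dec-true (toℕ v <? n) (toℕ<n v) = refl

count-between : ∀ {n} t s → t ≤ s → s ≤ n → count (λ (i : Fin n) → t ≤? toℕ i ×-dec toℕ i <? s) ≡ s ∸ t
count-between {n} t s t≤s s≤n = begin
  count between                                ≡⟨ m+n∸n≡m (count between) t ⟨
  count between + t ∸ t                        ≡⟨ cong (λ m → count between + m ∸ t) (count-< t (≤-trans t≤s s≤n)) ⟨
  count between + count {n} (λ i → toℕ i <? t) ∸ t ≡⟨ cong (_∸ t) (∑-distrib-+ (λ i → 𝟙 (does (between i))) (λ i → 𝟙 (does (toℕ i <? t)))) ⟨
  ∑[ i < n ] (𝟙 (does (between i)) + 𝟙 (does (toℕ i <? t))) ∸ t  ≡⟨ cong (_∸ t) (sum-cong-≗ {n} split) ⟨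
  count {n} (λ i → toℕ i <? s) ∸ t                 ≡⟨ cong (_∸ t) (count-< s s≤n) ⟩
  s ∸ t                                        ∎
  where
  open ≡-Reasoning
  between : ∀ (i : Fin n) → Dec (t ≤ toℕ i × toℕ i < s)
  between i = t ≤? toℕ i ×-dec toℕ i <? s
  split : ∀ i → 𝟙 (does (toℕ i <? s)) ≡ 𝟙 (does (between i)) + 𝟙 (does (toℕ i <? t))
  split i with toℕ i <? t
  ... | yes i<t rewrite dec-true (toℕ i <? t) i<t | dec-true (toℕ i <? s) (<-≤-trans i<t t≤s) | dec-false (t ≤? toℕ i) (<⇒≱ i<t) = refl
  ... | no  i≮t rewrite dec-false (toℕ i <? t) i≮t | dec-true (t ≤? toℕ i) (≮⇒≥ i≮t) = sym (+-identityʳ _)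

count-≡ : ∀ {n} (a : Fin n) → count (λ i → i ≟ a) ≤ 1
count-≡ {suc n} zero    = s≤s (≤-reflexive (sum-replicate-zero n))
count-≡ {suc n} (suc a) = count-≡ a

count-≥ : ∀ {n} s → s ≤ n → count (λ (i : Fin n) → ¬? (toℕ i <? s)) ≡ n ∸ s
count-≥ {n} s s≤n = begin
  count {n} (λ i → ¬? (toℕ i <? s))                                 ≡⟨ m+n∸m≡n s _ ⟨
  s + count {n} (λ i → ¬? (toℕ i <? s)) ∸ s                         ≡⟨ cong (λ m → m + count {n} (λ i → ¬? (toℕ i <? s)) ∸ s) (count-< s s≤n) ⟨
  count {n} (λ i → toℕ i <? s) + count {n} (λ i → ¬? (toℕ i <? s)) ∸ s  ≡⟨ cong (_∸ s) (count-complement {n} (λ i → toℕ i <? s)) ⟩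
  n ∸ s                                                         ∎
  where open ≡-Reasoning

∈-neighbours⁺ : (G : Graph n) {v w : Fin n} → adj G v w ≡ true → w ∈ filterᵇ (adj G v) (allFin n)
∈-neighbours⁺ G {v} {w} vw = ∈-filter⁺ (T? ∘ adj G v) (∈-allFin w) (subst T (sym vw) tt)

∈-neighbours⁻ : (G : Graph n) {v w : Fin n} → w ∈ filterᵇ (adj G v) (allFin n) → adj G v w ≡ true
∈-neighbours⁻ {n} G {v} {w} w∈ with adj G v w | proj₂ (∈-filter⁻ (T? ∘ adj G v) {xs = allFin n} w∈)
... | true | _ = refl

adj⇒≢ : (G : Graph n) {u v : Fin n} → adj G u v ≡ true → u ≢ v
adj⇒≢ G {u} uv refl = not-¬ uv (irrefl G u)

non-neighbour : (G : Graph n) (v : Fin n) → suc (deg G v) < n → ∃[ w ] (w ≢ v × adj G v w ≡ false)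
non-neighbour {n} G v room with any? (λ w → ¬? (w ≟ v) ×-dec (adj G v w Bool.≟ false))
... | yes found = found
... | no none = contradiction room (≤⇒≯ (begin
  n                                          ≡⟨ trans (∑-const n 1) (*-identityʳ n) ⟨
  count {n} (λ _ → yes tt)                   ≤⟨ count-∪ (λ _ → yes tt) (T? ∘ adj G v) (_≟ v) split ⟩
  count (T? ∘ adj G v) + count (_≟ v)       ≤⟨ +-mono-≤ (≤-reflexive (sym (deg≡∑ G v))) (count-≡ v) ⟩
  deg G v + 1                                ≡⟨ +-comm (deg G v) 1 ⟩
  suc (deg G v)                              ∎))
  where
  open ≤-Reasoning
  split : ∀ {w} → ⊤ → T (adj G v w) ⊎ w ≡ v
  split {w} _ with w ≟ v | adj G v w in vw
  ... | yes w≡v | _     = inj₂ w≡v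
  ... | no w≢v  | true  = inj₁ tt
  ... | no w≢v  | false = contradiction (w , w≢v , vw) none

-- Lists: pigeonhole principle and zips

lookup-injective : Unique xs → ∀ {i j} → lookup xs i ≡ lookup xs j → i ≡ j
lookup-injective (_ ∷ _)                {zero}  {zero}  _  = refl
lookup-injective {xs = _ ∷ xs} (x∉ ∷ _) {zero}  {suc j} eq = contradiction eq (All.lookup x∉ (∈-lookup {xs = xs} j))
lookup-injective {xs = _ ∷ xs} (x∉ ∷ _) {suc i} {zero}  eq = contradiction (sym eq) (All.lookup x∉ (∈-lookup {xs = xs} i))
lookup-injective (_ ∷ u)                {suc i} {suc j} eq = cong suc (lookup-injective u eq)

module _ (g : A → B) (unique : Unique xs) (maps : ∀ {x} → x ∈ xs → g x ∈ ys)
         (injective : ∀ {x x′} → x ∈ xs → x′ ∈ xs → g x ≡ g x′ → x ≡ x′) where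

  private
    position : Fin (length xs) → Fin (length ys)
    position i = index (maps (∈-lookup i))

    g-lookup : ∀ i → g (lookup xs i) ≡ lookup ys (position i)
    g-lookup i = lookup-index (maps (∈-lookup i))

    position-injective : ∀ {i j} → position i ≡ position j → i ≡ j
    position-injective {i} {j} eq = lookup-injective unique (injective (∈-lookup i) (∈-lookup j) (begin
      g (lookup xs i)      ≡⟨ g-lookup i ⟩
      lookup ys (position i) ≡⟨ cong (lookup ys) eq ⟩
      lookup ys (position j) ≡⟨ g-lookup j ⟨
      g (lookup xs j)      ∎))
      where open ≡-Reasoning

  length-≤-injectiveOn : length xs ≤ length ys
  length-≤-injectiveOn = injective⇒≤ position-injective

  length-<-injectiveOn : ∀ {y₀} → y₀ ∈ ys → (∀ {x} → x ∈ xs → g x ≢ y₀) → length xs < length ys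
  length-<-injectiveOn {y₀} y₀∈ys misses = injective⇒≤ extended-injective
    where
    extended : Fin (suc (length xs)) → Fin (length ys)
    extended zero    = index y₀∈ys
    extended (suc i) = position i

    y₀-missed : ∀ i → index y₀∈ys ≢ position i
    y₀-missed i eq = misses (∈-lookup i) (trans (g-lookup i) (trans (cong (lookup ys) (sym eq)) (sym (lookup-index y₀∈ys))))

    extended-injective : ∀ {i j} → extended i ≡ extended j → i ≡ j
    extended-injective {zero}  {zero}  _  = refl
    extended-injective {zero}  {suc j} eq = contradiction eq (y₀-missed j)
    extended-injective {suc i} {zero}  eq = contradiction (sym eq) (y₀-missed i)
    extended-injective {suc i} {suc j} eq = cong suc (position-injective eq)

∈-zip⁻ : (x , y) ∈ zip xs ys → x ∈ xs × y ∈ ys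
∈-zip⁻ {xs = _ ∷ _} {ys = _ ∷ _} (here refl) = here refl , here refl
∈-zip⁻ {xs = _ ∷ _} {ys = _ ∷ _} (there p) with ∈-zip⁻ p
... | x∈xs , y∈ys = there x∈xs , there y∈ys

∈-zip-injective : Unique ys → (x , y) ∈ zip xs ys → (x′ , y) ∈ zip xs ys → x ≡ x′
∈-zip-injective {xs = _ ∷ _} (_ ∷ _)  (here refl) (here refl) = refl
∈-zip-injective {xs = _ ∷ _} (y∉ ∷ _) (here refl) (there q)   = contradiction refl (All.lookup y∉ (proj₂ (∈-zip⁻ q)))
∈-zip-injective {xs = _ ∷ _} (y∉ ∷ _) (there p)   (here refl) = contradiction refl (All.lookup y∉ (proj₂ (∈-zip⁻ p)))
∈-zip-injective {xs = _ ∷ _} (_ ∷ u)  (there p)   (there q)   = ∈-zip-injective u p q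

∈-zip-partner : x ∈ xs → length xs ≤ length ys → ∃[ y ] (x , y) ∈ zip xs ys
∈-zip-partner {ys = y ∷ _} (here refl) _         = y , here refl
∈-zip-partner {ys = _ ∷ _} (there p)   (s≤s len) with ∈-zip-partner p len
... | y , q = y , there q

∈-zip-++⁻ : length xs₁ ≡ length ys₁ → (x , y) ∈ zip (xs₁ ++ xs₂) (ys₁ ++ ys₂) →
  (x ∈ xs₁ × y ∈ ys₁) ⊎ (x ∈ xs₂ × y ∈ ys₂)
∈-zip-++⁻ {xs₁ = []}    {ys₁ = []}    _   p           = inj₂ (∈-zip⁻ p)
∈-zip-++⁻ {xs₁ = _ ∷ _} {ys₁ = _ ∷ _} _   (here refl) = inj₁ (here refl , here refl)
∈-zip-++⁻ {xs₁ = _ ∷ _} {ys₁ = _ ∷ _} len (there p) with ∈-zip-++⁻ (suc-injective len) p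
... | inj₁ (x∈ , y∈) = inj₁ (there x∈ , there y∈)
... | inj₂ in₂       = inj₂ in₂

∈-take⁻ : ∀ {m} → x ∈ take m xs → x ∈ xs
∈-take⁻ {xs = _ ∷ _} {m = suc m} (here refl) = here refl
∈-take⁻ {xs = _ ∷ _} {m = suc m} (there p)   = there (∈-take⁻ p)

take-suc-zip : (xs : List A) (ys : List B) (i : Fin (length xs)) → length xs ≤ length ys →
  ∃[ y ] take (suc (toℕ i)) (zip xs ys) ≡ take (toℕ i) (zip xs ys) ++ [ (lookup xs i , y) ]
take-suc-zip (_ ∷ _)  (y ∷ _)  zero    _         = y , refl
take-suc-zip (x ∷ xs) (y ∷ ys) (suc i) (s≤s len) with take-suc-zip xs ys i len
... | y′ , eq = y′ , cong ((x , y) ∷_) eq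

lookup-++-< : (xs ys : List A) (i : Fin (length (xs ++ ys))) → toℕ i < length xs → lookup (xs ++ ys) i ∈ xs
lookup-++-< (_ ∷ _)  ys zero    _         = here refl
lookup-++-< (_ ∷ xs) ys (suc i) (s≤s i<) = there (lookup-++-< xs ys i i<)

lookup-++-≥ : (xs ys : List A) (i : Fin (length (xs ++ ys))) → length xs ≤ toℕ i → lookup (xs ++ ys) i ∈ ys
lookup-++-≥ []       ys i       _         = ∈-lookup i
lookup-++-≥ (_ ∷ xs) ys (suc i) (s≤s i≥) = lookup-++-≥ xs ys i i≥

∈-take-zip-++ : ∀ {m} → x ∈ xs₁ → length xs₁ ≤ m → length xs₁ ≤ length ys →
  ∃[ y ] (x , y) ∈ take m (zip (xs₁ ++ xs₂) ys)
∈-take-zip-++ {ys = y ∷ _} {m = suc _} (here refl) _ _ = y , here refl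
∈-take-zip-++ {ys = _ ∷ _} {m = suc _} (there p) (s≤s m≥) (s≤s ys≥) with ∈-take-zip-++ p m≥ ys≥
... | y , q = y , there q

split-at-first : ∀ {P : A → Set} → (∀ x → Dec (P x)) → Any P xs →
  ∃[ pre ] ∃[ e ] ∃[ post ] (xs ≡ pre ++ e ∷ post × All (λ y → ¬ P y) pre × P e)
split-at-first {xs = xs} P? any with First.first (λ x → Sum.swap (toSum (P? x))) xs
... | inj₂ none = contradiction any (All¬⇒¬Any none)
... | inj₁ fst with toView fst
...   | First._++_∷_ {pre} {e} pre-avoids pe post = pre , e , post , refl , pre-avoids , pe

position-of : (xs : List A) (y : A) (ys : List A) →
  ∃[ i ] (toℕ i ≡ length xs × lookup (xs ++ y ∷ ys) i ≡ y)
position-of []       y ys = zero , refl , refl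
position-of (_ ∷ xs) y ys with position-of xs y ys
... | i , i≡ , lookup≡ = suc i , cong suc i≡ , lookup≡

take-zip-++-∷ : ∀ {zs : List B} {c cs} → length zs ≡ length xs →
  take (suc (length xs)) (zip (xs ++ x ∷ xs₂) (zs ++ c ∷ cs)) ≡ zip xs zs ++ [ (x , c) ]
take-zip-++-∷ {xs = []}    {zs = []}    _   = refl
take-zip-++-∷ {xs = _ ∷ _} {zs = _ ∷ _} len = cong (_ ∷_) (take-zip-++-∷ (suc-injective len))

length-≤-⊆ : ∀ {A : Set} {xs ys : List A} → Unique xs → (∀ {x} → x ∈ xs → x ∈ ys) → length xs ≤ length ys
length-≤-⊆ unique ⊆ = length-≤-injectiveOn (λ x → x) unique ⊆ (λ _ _ eq → eq)

freshColours : ℕ → ℕ → List ℕ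
freshColours from m = applyUpTo (from +_) m

∈-freshColours⁻ : ∀ {x} from m → x ∈ freshColours from m → from ≤ x × x < from + m
∈-freshColours⁻ from m x∈ with ∈-applyUpTo⁻ (from +_) x∈
... | i , i<m , refl = m≤m+n from i , +-monoʳ-< from i<m

freshColours-unique : ∀ from m → Unique (freshColours from m)
freshColours-unique from m = applyUpTo⁺₁ (from +_) m (λ i<j _ eq → <⇒≢ i<j (+-cancelˡ-≡ from _ _ eq))

colours-around : ∀ (α m m′ : ℕ) → Unique (freshColours (suc α) m ++ α ∷ freshColours (suc α + m) m′)
colours-around α m m′ = ++⁺ (freshColours-unique (suc α) m) (All.tabulate α∉ ∷ freshColours-unique (suc α + m) m′) disjoint
  where
  α∉ : ∀ {x} → x ∈ freshColours (suc α + m) m′ → α ≢ x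
  α∉ x∈ refl = <⇒≱ (s≤s (m≤m+n α m)) (proj₁ (∈-freshColours⁻ (suc α + m) m′ x∈))
  disjoint : ∀ {x} → ¬ (x ∈ freshColours (suc α) m × x ∈ α ∷ freshColours (suc α + m) m′)
  disjoint (x∈ , here refl) = <-irrefl refl (proj₁ (∈-freshColours⁻ (suc α) m x∈))
  disjoint (x∈ , there x∈′) = <⇒≱ (proj₂ (∈-freshColours⁻ (suc α) m x∈)) (proj₁ (∈-freshColours⁻ (suc α + m) m′ x∈′))

not-does⇒¬ : (a? : Dec A) → not (does a?) ≡ true → ¬ A
not-does⇒¬ (no ¬a) _ = ¬a

⌊⌋⇒ : (a? : Dec A) → ⌊ a? ⌋ ≡ true → A
⌊⌋⇒ (yes a) _ = a

∨-true⁻ : ∀ a {b} → a ∨ b ≡ true → a ≡ true ⊎ b ≡ true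
∨-true⁻ true  _  = inj₁ refl
∨-true⁻ false eq = inj₂ eq

∨-trueʳ : ∀ a {b} → b ≡ true → a ∨ b ≡ true
∨-trueʳ true  _  = refl
∨-trueʳ false eq = eq

-- Adding coloured edges

State : ℕ → Set
State n = Adj n × Col n

Entry : ℕ → Set
Entry n = (Fin n × Fin n) × ℕ

Touches : Entry n → Fin n → Fin n → Set
Touches (e , _) u v = samePair e u v ≡ true

Touches? : (ec : Entry n) (u v : Fin n) → Dec (Touches ec u v)
Touches? (e , _) u v = samePair e u v Bool.≟ true

samePair-sym : (e : Fin n × Fin n) (u v : Fin n) → samePair e u v ≡ samePair e v u
samePair-sym (a , b) u v = ∨-comm (⌊ a ≟ u ⌋ ∧ ⌊ b ≟ v ⌋) (⌊ a ≟ v ⌋ ∧ ⌊ b ≟ u ⌋)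

samePair-refl : (a b : Fin n) → samePair (a , b) a b ≡ true
samePair-refl a b with a ≟ a | b ≟ b
... | yes _   | yes _   = refl
... | no a≢a  | _       = contradiction refl a≢a
... | yes _   | no b≢b  = contradiction refl b≢b

samePair⁻ : ∀ {a b u v : Fin n} → samePair (a , b) u v ≡ true → SameEdge a b u v
samePair⁻ {a = a} {b} {u} {v} eq with ∨-true⁻ (⌊ a ≟ u ⌋ ∧ ⌊ b ≟ v ⌋) eq
... | inj₁ eq₁ = inj₁ (⌊⌋⇒ (a ≟ u) (∧-conicalˡ _ _ eq₁) , ⌊⌋⇒ (b ≟ v) (∧-conicalʳ _ _ eq₁))
... | inj₂ eq₂ = inj₂ (⌊⌋⇒ (a ≟ v) (∧-conicalˡ _ _ eq₂) , ⌊⌋⇒ (b ≟ u) (∧-conicalʳ _ _ eq₂))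

addEdges-adj-mono : (s : State n) (es : List (Entry n)) {u v : Fin n} →
  proj₁ s u v ≡ true → proj₁ (addEdges s es) u v ≡ true
addEdges-adj-mono s       []              uv = uv
addEdges-adj-mono (A , C) ((e , c) ∷ es) {u} {v} uv =
  addEdges-adj-mono (addEdge (A , C) (e , c)) es (∨-trueʳ (samePair e u v) uv)

addEdges-adj-∈ : (s : State n) (es : List (Entry n)) {u v : Fin n} {ec : Entry n} →
  ec ∈ es → Touches ec u v → proj₁ (addEdges s es) u v ≡ true
addEdges-adj-∈ (A , C) (ec ∷ es) (here refl) touches =
  addEdges-adj-mono (addEdge (A , C) ec) es (subst (λ b → b ∨ _ ≡ true) (sym touches) refl)
addEdges-adj-∈ (A , C) (ec ∷ es) (there p) touches = addEdges-adj-∈ (addEdge (A , C) ec) es p touches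

addEdges-adj⁻ : (s : State n) (es : List (Entry n)) {u v : Fin n} →
  proj₁ (addEdges s es) u v ≡ true → proj₁ s u v ≡ true ⊎ Any (λ ec → Touches ec u v) es
addEdges-adj⁻ s       []              uv = inj₁ uv
addEdges-adj⁻ (A , C) ((e , c) ∷ es) {u} {v} uv with addEdges-adj⁻ (addEdge (A , C) (e , c)) es uv
... | inj₂ touched = inj₂ (there touched)
... | inj₁ uv′ with ∨-true⁻ (samePair e u v) uv′
...   | inj₁ touches = inj₂ (here touches)
...   | inj₂ uv″     = inj₁ uv″

addEdges-col-untouched : (s : State n) (es : List (Entry n)) {u v : Fin n} →
  All (λ ec → ¬ Touches ec u v) es → proj₂ (addEdges s es) u v ≡ proj₂ s u v
addEdges-col-untouched s       []              []                 = refl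
addEdges-col-untouched (A , C) ((e , c) ∷ es) {u} {v} (¬touches ∷ rest) =
  trans (addEdges-col-untouched (addEdge (A , C) (e , c)) es rest)
        (cong (λ b → if b then c else C u v) (¬-not ¬touches))

addEdges-col-touched : (s : State n) (es : List (Entry n)) {u v : Fin n} →
  Any (λ ec → Touches ec u v) es → ∃[ e ] ((e , proj₂ (addEdges s es) u v) ∈ es × samePair e u v ≡ true)
addEdges-col-touched (A , C) ((e , c) ∷ es) {u} {v} touched
  with Any.any? (λ ec → Touches? ec u v) es
... | yes later with addEdges-col-touched (addEdge (A , C) (e , c)) es later
...   | e′ , e′∈es , touches = e′ , there e′∈es , touches
addEdges-col-touched (A , C) ((e , c) ∷ es) {u} {v} (here touches) | no none =
  e , subst (λ c′ → (e , c′) ∈ (e , c) ∷ es) (sym last-colour) (here refl) , touches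
  where
  last-colour : proj₂ (addEdges (addEdge (A , C) (e , c)) es) u v ≡ c
  last-colour = trans (addEdges-col-untouched (addEdge (A , C) (e , c)) es (¬Any⇒All¬ es none))
                      (cong (λ b → if b then c else C u v) touches)
addEdges-col-touched (A , C) ((e , c) ∷ es) (there later) | no none = contradiction later none

addEdges-adj-sym : (s : State n) (es : List (Entry n)) → (∀ u v → proj₁ s u v ≡ proj₁ s v u) →
  ∀ u v → proj₁ (addEdges s es) u v ≡ proj₁ (addEdges s es) v u
addEdges-adj-sym s       []              sym-s = sym-s
addEdges-adj-sym (A , C) ((e , c) ∷ es) sym-s =
  addEdges-adj-sym (addEdge (A , C) (e , c)) es (λ u v → cong₂ _∨_ (samePair-sym e u v) (sym-s u v))

addEdges-col-sym : (s : State n) (es : List (Entry n)) → (∀ u v → proj₂ s u v ≡ proj₂ s v u) →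
  ∀ u v → proj₂ (addEdges s es) u v ≡ proj₂ (addEdges s es) v u
addEdges-col-sym s       []              sym-s = sym-s
addEdges-col-sym (A , C) ((e , c) ∷ es) sym-s =
  addEdges-col-sym (addEdge (A , C) (e , c)) es
    (λ u v → cong₂ (λ b c′ → if b then c else c′) (samePair-sym e u v) (sym-s u v))

addEdges-last : (s : State n) (es : List (Entry n)) (a b : Fin n) (c : ℕ) →
  proj₁ (addEdges s (es ++ [ ((a , b) , c) ])) a b ≡ true × proj₂ (addEdges s (es ++ [ ((a , b) , c) ])) a b ≡ c
addEdges-last s es a b c rewrite foldl-++ addEdge s es [ ((a , b) , c) ] | samePair-refl a b = refl , refl

SameEdge-fst : ∀ {a b u v : Fin n} → SameEdge a b u v → a ≡ u ⊎ a ≡ v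
SameEdge-fst (inj₁ (a≡u , _)) = inj₁ a≡u
SameEdge-fst (inj₂ (a≡v , _)) = inj₂ a≡v

SameEdge-snd : ∀ {a b u v : Fin n} → SameEdge a b u v → b ≡ u ⊎ b ≡ v
SameEdge-snd (inj₁ (_ , b≡v)) = inj₂ b≡v
SameEdge-snd (inj₂ (_ , b≡u)) = inj₁ b≡u

SameEdge-via : ∀ {a b u v u′ v′ : Fin n} → SameEdge a b u v → SameEdge a b u′ v′ → SameEdge u v u′ v′
SameEdge-via (inj₁ (refl , refl)) (inj₁ (refl , refl)) = inj₁ (refl , refl)
SameEdge-via (inj₁ (refl , refl)) (inj₂ (refl , refl)) = inj₂ (refl , refl)
SameEdge-via (inj₂ (refl , refl)) (inj₁ (refl , refl)) = inj₂ (refl , refl)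
SameEdge-via (inj₂ (refl , refl)) (inj₂ (refl , refl)) = inj₁ (refl , refl)

SameEdge-injective : ∀ {k} (φ : Fin k → Fin n) → (∀ {u v} → φ u ≡ φ v → u ≡ v) →
  ∀ {u v u′ v′} → SameEdge (φ u) (φ v) (φ u′) (φ v′) → SameEdge u v u′ v′
SameEdge-injective φ inj (inj₁ (eq₁ , eq₂)) = inj₁ (inj eq₁ , inj eq₂)
SameEdge-injective φ inj (inj₂ (eq₁ , eq₂)) = inj₂ (inj eq₁ , inj eq₂)

-- An added pair can only share its colour with another added pair if they are the same entry of
-- the (duplicate-free) colour list, and base colours are injective; so the only collisions left
-- to exclude are between a base edge and an added edge of the copy.
module RainbowAssembly
  {n} (A₀ : Adj n) (C₀ : Col n) (A₀-sym : ∀ u v → A₀ u v ≡ A₀ v u)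
  (C₀-injective : ∀ {u v u′ v′} → C₀ u v ≡ C₀ u′ v′ → SameEdge u v u′ v′)
  (L : List (Fin n × Fin n)) (L-nonedges : ∀ {u v} → (u , v) ∈ L → A₀ u v ≡ false)
  (cs : List ℕ) (cs-unique : Unique cs)
  (es : List (Entry n)) (es⊆zip : ∀ {ec} → ec ∈ es → ec ∈ zip L cs)
  where

  stA : Adj n
  stA = proj₁ (addEdges (A₀ , C₀) es)

  stC : Col n
  stC = proj₂ (addEdges (A₀ , C₀) es)

  entry-nonedge : ∀ {a b c} → ((a , b) , c) ∈ es → A₀ a b ≡ false
  entry-nonedge ec∈es = L-nonedges (proj₁ (∈-zip⁻ (es⊆zip ec∈es)))

  colour-of-base-edge : ∀ {u v} → A₀ u v ≡ true → stC u v ≡ C₀ u v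
  colour-of-base-edge {u} {v} uv = addEdges-col-untouched (A₀ , C₀) es (All.tabulate untouched)
    where
    untouched : ∀ {ec} → ec ∈ es → ¬ Touches ec u v
    untouched {((a , b) , c)} ec∈es touches with samePair⁻ {a = a} {b} {u} {v} touches
    ... | inj₁ (refl , refl) = not-¬ uv (entry-nonedge ec∈es)
    ... | inj₂ (refl , refl) = not-¬ (trans (A₀-sym v u) uv) (entry-nonedge ec∈es)

  colour-of-added-edge : ∀ {u v} → A₀ u v ≡ false → stA u v ≡ true →
    ∃[ e ] ((e , stC u v) ∈ es × samePair e u v ≡ true)
  colour-of-added-edge {u} {v} ¬uv uv with addEdges-adj⁻ (A₀ , C₀) es uv
  ... | inj₁ uv₀    = contradiction ¬uv (not-¬ uv₀)
  ... | inj₂ touched = addEdges-col-touched (A₀ , C₀) es touched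

  rainbowCopy : {H : Graph k} (φ : Fin k → Fin n) (φ-injective : ∀ {u v} → φ u ≡ φ v → u ≡ v) →
    (∀ u v → adj H u v ≡ true → stA (φ u) (φ v) ≡ true) →
    (∀ {u v u′ v′} → adj H u v ≡ true → adj H u′ v′ ≡ true →
       A₀ (φ u) (φ v) ≡ true → A₀ (φ u′) (φ v′) ≡ false → C₀ (φ u) (φ v) ≢ stC (φ u′) (φ v′)) →
    ∀ {a b} → ∃[ u ] ∃[ v ] (adj H u v ≡ true × φ u ≡ a × φ v ≡ b) →
    RainbowCopyContaining H (addEdges (A₀ , C₀) es) (a , b)
  rainbowCopy {H = H} φ φ-injective edges separated through = φ , (λ _ _ → φ-injective) , edges , rainbow , through
    where
    rainbow : ∀ u v u′ v′ → adj H u v ≡ true → adj H u′ v′ ≡ true → ¬ SameEdge u v u′ v′ →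
      stC (φ u) (φ v) ≢ stC (φ u′) (φ v′)
    rainbow u v u′ v′ uv u′v′ distinct same-colour
      with A₀ (φ u) (φ v) in base | A₀ (φ u′) (φ v′) in base′
    ... | true  | true  = distinct (SameEdge-injective φ φ-injective (C₀-injective
                            (trans (sym (colour-of-base-edge base)) (trans same-colour (colour-of-base-edge base′)))))
    ... | true  | false = separated uv u′v′ base base′ (trans (sym (colour-of-base-edge base)) same-colour)
    ... | false | true  = separated u′v′ uv base′ base (trans (sym (colour-of-base-edge base′)) (sym same-colour))
    ... | false | false with colour-of-added-edge base (edges u v uv) | colour-of-added-edge base′ (edges u′ v′ u′v′)
    ...   | (p , q) , e∈es , touches | (p′ , q′) , e′∈es , touches′
      with ∈-zip-injective cs-unique (es⊆zip e∈es) (subst (λ c → ((p′ , q′) , c) ∈ zip L cs) (sym same-colour) (es⊆zip e′∈es))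
    ...   | refl = distinct (SameEdge-injective φ φ-injective
                     (SameEdge-via (samePair⁻ {a = p} {q} touches) (samePair⁻ {a = p} {q} touches′)))

-- The extremal number of ℋ

¬¬-least : (P : ℕ → Set) → ∀ {m} → P m → ¬ ¬ (∃[ e ] (P e × ∀ e′ → P e′ → e ≤ e′))
¬¬-least P {m} Pm ¬least = <-rec (λ m → ¬ P m) smallest m Pm
  where
  smallest : ∀ m → (∀ {e} → e < m → ¬ P e) → ¬ P m
  smallest m below Pm = ¬least (m , Pm , λ e Pe → ≮⇒≥ (λ e<m → below e<m Pe))

-- FProp only speaks about the least admissible bound on ex(N, ℋ), whose existence is classical;
-- the conclusion is decidable, so a double-negated least element suffices.
FProp-bound : {H : Graph k} → FProp H n → N ≡ n ⊎ suc N ≡ n →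
  ∀ m → (∀ e → ExAtMost H N e → m ≤ e) → m + 2 * N + 2 ≤ N C 2
FProp-bound {N = N} {H = H} FP N∈ m m≤ex = decidable-stable (m + 2 * N + 2 ≤? N C 2) λ ¬bound →
  ¬¬-least (ExAtMost H N) (λ G _ → eCount≤C2 G) λ (e , e-bounds , e-least) →
    ¬bound (≤-trans (+-monoˡ-≤ 2 (+-monoˡ-≤ (2 * N) (m≤ex e e-bounds))) (FP N N∈ e e-bounds e-least))

free⇒sparse : {H : Graph k} → FProp H n → N ≡ n ⊎ suc N ≡ n →
  (G : Graph N) → ¬ ContainsFamily H G → eCount G + 2 * N + 2 ≤ N C 2
free⇒sparse {n = n} {H = H} FP N∈ G free = FProp-bound {n = n} {H = H} FP N∈ (eCount G) (λ e e-bounds → e-bounds G free)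

FProp⇒2≤ : {H : Graph k} → FProp H n → 2 ≤ n
FProp⇒2≤ {n = zero}     {H} FP with FProp-bound {H = H} FP (inj₁ refl) 0 (λ _ _ → z≤n)
... | ()
FProp⇒2≤ {n = suc zero} {H} FP with FProp-bound {H = H} FP (inj₁ refl) 0 (λ _ _ → z≤n)
... | ()
FProp⇒2≤ {n = suc (suc n)}  FP = s≤s (s≤s z≤n)

TotalCopyOfDel : Graph k → Fin k → Fin k → Graph N → (Fin k → Fin N) → Set
TotalCopyOfDel H x y G ψ =
  (∀ u w → u ≢ x → u ≢ y → w ≢ x → w ≢ y → ψ u ≡ ψ w → u ≡ w) ×
  (∀ u w → u ≢ x → u ≢ y → w ≢ x → w ≢ y → adj H u w ≡ true → adj G (ψ u) (ψ w) ≡ true)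

TotalCopyOfDel? : (H : Graph k) (x y : Fin k) (G : Graph N) (ψ : Fin k → Fin N) → Dec (TotalCopyOfDel H x y G ψ)
TotalCopyOfDel? H x y G ψ =
  (all? λ u → all? λ w → ¬? (u ≟ x) →-dec ¬? (u ≟ y) →-dec ¬? (w ≟ x) →-dec ¬? (w ≟ y) →-dec
                          ψ u ≟ ψ w →-dec u ≟ w)
  ×-dec
  (all? λ u → all? λ w → ¬? (u ≟ x) →-dec ¬? (u ≟ y) →-dec ¬? (w ≟ x) →-dec ¬? (w ≟ y) →-dec
                          adj H u w Bool.≟ true →-dec adj G (ψ u) (ψ w) Bool.≟ true)

TotalCopyOfDel-resp : {H : Graph k} {x y : Fin k} {G : Graph N} {ψ ψ′ : Fin k → Fin N} →
  ψ ≗ ψ′ → TotalCopyOfDel H x y G ψ → TotalCopyOfDel H x y G ψ′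
TotalCopyOfDel-resp {G = G} ψ≗ψ′ (injective , edges) =
  (λ u w u≢x u≢y w≢x w≢y eq → injective u w u≢x u≢y w≢x w≢y (trans (ψ≗ψ′ u) (trans eq (sym (ψ≗ψ′ w))))) ,
  (λ u w u≢x u≢y w≢x w≢y uw → subst₂ (λ p q → adj G p q ≡ true) (ψ≗ψ′ u) (ψ≗ψ′ w) (edges u w u≢x u≢y w≢x w≢y uw))

∃-function? : ∀ k {Q : (Fin k → Fin N) → Set} → (∀ {ψ ψ′} → ψ ≗ ψ′ → Q ψ → Q ψ′) →
  (∀ ψ → Dec (Q ψ)) → Dec (∃ Q)
∃-function? zero resp Q? with Q? (λ ())
... | yes q = yes (_ , q)
... | no ¬q = no λ (_ , q) → ¬q (resp (λ ()) q)
∃-function? (suc k) resp Q? with any? (λ a → ∃-function? k (resp ∘ ∷-cong refl) (λ ψ → Q? (a Vector.∷ ψ)))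
... | yes (a , ψ , q) = yes (a Vector.∷ ψ , q)
... | no none         = no λ (ψ , q) → none (ψ zero , ψ ∘ suc , resp (∷-cong refl λ _ → refl) q)

totalise : {H : Graph k} {G : Graph N} {x y : Fin k} → Fin N → CopyOfDel H x y G → ∃ (TotalCopyOfDel H x y G)
totalise {k} {N} {H} {G} {x} {y} default (φ , φ-injective , φ-edges) = ψ , ψ-injective , ψ-edges
  where
  ψ : Fin k → Fin N
  ψ u with u ≟ x | u ≟ y
  ... | no u≢x | no u≢y = φ u u≢x u≢y
  ... | _      | _      = default

  ψ-agrees : ∀ {u} → u ≢ x → u ≢ y → ∃[ p ] ∃[ q ] ψ u ≡ φ u p q
  ψ-agrees {u} u≢x u≢y with u ≟ x | u ≟ y
  ... | no p    | no q    = p , q , refl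
  ... | yes u≡x | _       = contradiction u≡x u≢x
  ... | no _    | yes u≡y = contradiction u≡y u≢y

  ψ-injective : ∀ u w → u ≢ x → u ≢ y → w ≢ x → w ≢ y → ψ u ≡ ψ w → u ≡ w
  ψ-injective u w u≢x u≢y w≢x w≢y eq with ψ-agrees u≢x u≢y | ψ-agrees w≢x w≢y
  ... | p , q , ψu≡ | p′ , q′ , ψw≡ = φ-injective u w p q p′ q′ (trans (sym ψu≡) (trans eq ψw≡))

  ψ-edges : ∀ u w → u ≢ x → u ≢ y → w ≢ x → w ≢ y → adj H u w ≡ true → adj G (ψ u) (ψ w) ≡ true
  ψ-edges u w u≢x u≢y w≢x w≢y uw with ψ-agrees u≢x u≢y | ψ-agrees w≢x w≢y
  ... | p , q , ψu≡ | p′ , q′ , ψw≡ = subst₂ (λ a b → adj G a b ≡ true) (sym ψu≡) (sym ψw≡) (φ-edges u w p q p′ q′ uw)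

ContainsFamily⇒order≤ : {H : Graph k} {G : Graph N} → Fin N → ContainsFamily H G → k ≤ N + 2
ContainsFamily⇒order≤ {k} {N} {H} {G} default (x , y , _ , copy) = begin
  k                          ≡⟨ length-tabulate {n = k} (λ u → u) ⟨
  length (allFin k)          ≤⟨ length-≤-⊆ (allFin⁺ k) covered ⟩
  2 + length others          ≤⟨ +-monoʳ-≤ 2 (length-≤-injectiveOn ψ (filter⁺ avoids? (allFin⁺ k)) (λ _ → ∈-allFin _) ψ-injective) ⟩
  2 + length (allFin N)      ≡⟨ cong (2 +_) (length-tabulate {n = N} (λ v → v)) ⟩
  2 + N                      ≡⟨ +-comm 2 N ⟩
  N + 2                      ∎
  where
  open ≤-Reasoning
  avoids? : ∀ u → Dec (u ≢ x × u ≢ y)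
  avoids? u = ¬? (u ≟ x) ×-dec ¬? (u ≟ y)
  others : List (Fin k)
  others = filter avoids? (allFin k)
  total : ∃ (TotalCopyOfDel H x y G)
  total = totalise {H = H} {G = G} default copy
  ψ : Fin k → Fin N
  ψ = proj₁ total
  ψ-injective : ∀ {u w} → u ∈ others → w ∈ others → ψ u ≡ ψ w → u ≡ w
  ψ-injective {u} {w} u∈ w∈ with proj₂ (∈-filter⁻ avoids? {xs = allFin k} u∈) | proj₂ (∈-filter⁻ avoids? {xs = allFin k} w∈)
  ... | u≢x , u≢y | w≢x , w≢y = proj₁ (proj₂ total) u w u≢x u≢y w≢x w≢y
  covered : ∀ {u} → u ∈ allFin k → u ∈ x ∷ y ∷ others
  covered {u} _ with u ≟ x | u ≟ y
  ... | yes refl | _        = here refl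
  ... | no _     | yes refl = there (here refl)
  ... | no u≢x   | no u≢y   = there (there (∈-filter⁺ avoids? (∈-allFin u) (u≢x , u≢y)))

no-room : ∀ a b → ¬ (a + b + 2 ≤ a)
no-room a b le = m+1+n≰m a (≤-trans (≤-reflexive (sym (trans (+-assoc a b 2) (cong (a +_) (+-suc b 1))))) le)

FProp⇒order≤ : {H : Graph k} → FProp H n → k ≤ n + 1
FProp⇒order≤ {k} {H = H} FP with FProp⇒2≤ {H = H} FP
... | s≤s (s≤s {n = m} z≤n) = decidable-stable (k ≤? suc (suc m) + 1) λ k≰ →
  no-room (suc m C 2) (2 * suc m)
    (subst (λ e → e + 2 * suc m + 2 ≤ suc m C 2) (eCount-K (suc m))
      (free⇒sparse {H = H} FP (inj₂ refl) (K (suc m)) λ copy →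
        k≰ (≤-trans (ContainsFamily⇒order≤ {H = H} {G = K (suc m)} zero copy) (≤-reflexive (+-suc (suc m) 1)))))

copy-avoiding? : (H : Graph k) (G : Graph N) (x y : Fin k) → Dec (adj H x y ≡ true × ∃ (TotalCopyOfDel H x y G))
copy-avoiding? {k} H G x y =
  (adj H x y Bool.≟ true) ×-dec ∃-function? k (TotalCopyOfDel-resp {H = H} {x = x} {y = y} {G = G}) (TotalCopyOfDel? H x y G)

-- Exhaustive search over all maps Fin k → Fin n turns the classical density bound into a copy.
dense⇒copy : {H : Graph k} → FProp H n → Fin n → (G : Graph n) → n C 2 ≤ eCount G + 2 * n + 1 →
  ∃[ x ] ∃[ y ] (adj H x y ≡ true × ∃ (TotalCopyOfDel H x y G))
dense⇒copy {k} {n} {H} FP default G dense with any? (λ x → any? (λ y → copy-avoiding? H G x y))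
... | yes found = found
... | no none   = contradiction (+-cancelˡ-≤ (eCount G + 2 * n) 2 1 (≤-trans (free⇒sparse {H = H} FP (inj₁ refl) G free) dense)) (<-irrefl refl)
  where
  free : ¬ ContainsFamily H G
  free (x , y , xy , copy) = none (x , y , xy , totalise {H = H} {G = G} default copy)

-- The upper-bound construction

min-max-cases : ∀ a b → (a ⊓ b ≡ a × a ⊔ b ≡ b) ⊎ (a ⊓ b ≡ b × a ⊔ b ≡ a)
min-max-cases a b with ≤-total a b
... | inj₁ a≤b = inj₁ (m≤n⇒m⊓n≡m a≤b , m≤n⇒m⊔n≡n a≤b)
... | inj₂ b≤a = inj₂ (m≥n⇒m⊓n≡n b≤a , m≥n⇒m⊔n≡m b≤a)

min-max-injective : ∀ {a b c d} → a ⊓ b ≡ c ⊓ d → a ⊔ b ≡ c ⊔ d → (a ≡ c × b ≡ d) ⊎ (a ≡ d × b ≡ c)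
min-max-injective {a} {b} {c} {d} min≡ max≡ with min-max-cases a b | min-max-cases c d
... | inj₁ (p , q) | inj₁ (p′ , q′) = inj₁ (trans (sym p) (trans min≡ p′) , trans (sym q) (trans max≡ q′))
... | inj₁ (p , q) | inj₂ (p′ , q′) = inj₂ (trans (sym p) (trans min≡ p′) , trans (sym q) (trans max≡ q′))
... | inj₂ (p , q) | inj₁ (p′ , q′) = inj₂ (trans (sym q) (trans max≡ q′) , trans (sym p) (trans min≡ p′))
... | inj₂ (p , q) | inj₂ (p′ , q′) = inj₁ (trans (sym q) (trans max≡ q′) , trans (sym p) (trans min≡ p′))

module Construction (n : ℕ) {{n≢0 : NonZero n}} (s t : ℕ) (t≤s : t ≤ s) (s≤n : s ≤ n) where

  inS inT : Fin n → Bool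
  inS v = does (toℕ v <? s)
  inT v = does (toℕ v <? t)

  adjacent : Fin n → Fin n → Bool
  adjacent u v = not (does (u ≟ v)) ∧ (inS u ∧ inS v ∨ inT u ∨ inT v)

  adjacent-sym : ∀ u v → adjacent u v ≡ adjacent v u
  adjacent-sym u v = cong₂ _∧_ (cong not (≟-sym u v)) (cong₂ _∨_ (∧-comm (inS u) (inS v)) (∨-comm (inT u) (inT v)))

  adjacent-irrefl : ∀ u → adjacent u u ≡ false
  adjacent-irrefl u rewrite dec-true (u ≟ u) refl = refl

  adjacent-S : ∀ {u v} → toℕ u < s → toℕ v < s → u ≢ v → adjacent u v ≡ true
  adjacent-S {u} {v} u<s v<s u≢v rewrite dec-false (u ≟ v) u≢v | dec-true (toℕ u <? s) u<s | dec-true (toℕ v <? s) v<s = refl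

  adjacent-T : ∀ {u v} → toℕ u < t → u ≢ v → adjacent u v ≡ true
  adjacent-T {u} {v} u<t u≢v rewrite dec-false (u ≟ v) u≢v | dec-true (toℕ u <? t) u<t with inS u ∧ inS v
  ... | true  = refl
  ... | false = refl

  nonadjacent : ∀ {u v} → t ≤ toℕ u → s ≤ toℕ v → adjacent u v ≡ false
  nonadjacent {u} {v} t≤u s≤v
    rewrite dec-false (toℕ v <? s) (≤⇒≯ s≤v) | dec-false (toℕ u <? t) (≤⇒≯ t≤u)
          | dec-false (toℕ v <? t) (≤⇒≯ (≤-trans t≤s s≤v)) | ∧-zeroʳ (inS u) = ∧-zeroʳ (not (does (u ≟ v)))

  construction : Graph n
  construction = record { adj = adjacent ; sym = adjacent-sym ; irrefl = adjacent-irrefl }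

  colour : Fin n → Fin n → ℕ
  colour u v = toℕ u ⊓ toℕ v + (toℕ u ⊔ toℕ v) * n

  colour-sym : ∀ u v → colour u v ≡ colour v u
  colour-sym u v = cong₂ (λ lo hi → lo + hi * n) (⊓-comm (toℕ u) (toℕ v)) (⊔-comm (toℕ u) (toℕ v))

  colour%n : ∀ u v → colour u v % n ≡ toℕ u ⊓ toℕ v
  colour%n u v = trans ([m+kn]%n≡m%n (toℕ u ⊓ toℕ v) (toℕ u ⊔ toℕ v) n) (m<n⇒m%n≡m (≤-<-trans (m⊓n≤m (toℕ u) (toℕ v)) (toℕ<n u)))

  colour/n : ∀ u v → colour u v / n ≡ toℕ u ⊔ toℕ v
  colour/n u v = begin
    colour u v / n                                      ≡⟨ +-distrib-/-∣ʳ (toℕ u ⊓ toℕ v) (divides-refl (toℕ u ⊔ toℕ v)) ⟩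
    (toℕ u ⊓ toℕ v) / n + (toℕ u ⊔ toℕ v) * n / n       ≡⟨ cong₂ _+_ (m<n⇒m/n≡0 (≤-<-trans (m⊓n≤m (toℕ u) (toℕ v)) (toℕ<n u))) (m*n/n≡m (toℕ u ⊔ toℕ v) n) ⟩
    toℕ u ⊔ toℕ v                                       ∎
    where open ≡-Reasoning

  colour-injective : ∀ {u v u′ v′} → colour u v ≡ colour u′ v′ → SameEdge u v u′ v′
  colour-injective {u} {v} {u′} {v′} eq
    with min-max-injective (trans (sym (colour%n u v)) (trans (cong (_% n) eq) (colour%n u′ v′)))
                           (trans (sym (colour/n u v)) (trans (cong (_/ n) eq) (colour/n u′ v′)))
  ... | inj₁ (p , q) = inj₁ (toℕ-injective p , toℕ-injective q)
  ... | inj₂ (p , q) = inj₂ (toℕ-injective p , toℕ-injective q)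

  colouredConstruction : ColGraph n
  colouredConstruction = record { graph = construction ; col = colour ; colSym = colour-sym }

  pairs : List (Fin n × Fin n)
  pairs = cartesianProduct (allFin n) (allFin n)

  InPhase₁ InPhase₂ : Fin n × Fin n → Set
  InPhase₁ (a , b) = t ≤ toℕ a × toℕ a < s × s ≤ toℕ b
  InPhase₂ (a , b) = s ≤ toℕ a × toℕ a < toℕ b

  inPhase₁? : Decidable InPhase₁
  inPhase₁? (a , b) = t ≤? toℕ a ×-dec toℕ a <? s ×-dec s ≤? toℕ b

  inPhase₂? : Decidable InPhase₂
  inPhase₂? (a , b) = s ≤? toℕ a ×-dec toℕ a <? toℕ b

  phase₁ phase₂ ordering : List (Fin n × Fin n)
  phase₁   = filter inPhase₁? pairs
  phase₂   = filter inPhase₂? pairs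
  ordering = phase₁ ++ phase₂

  phase₁-nonedge : ∀ {a b} → InPhase₁ (a , b) → toℕ a < toℕ b × adjacent a b ≡ false
  phase₁-nonedge (t≤a , a<s , s≤b) = <-≤-trans a<s s≤b , nonadjacent t≤a s≤b

  phase₂-nonedge : ∀ {a b} → InPhase₂ (a , b) → toℕ a < toℕ b × adjacent a b ≡ false
  phase₂-nonedge (s≤a , a<b) = a<b , nonadjacent (≤-trans t≤s s≤a) (≤-trans s≤a (<⇒≤ a<b))

  ordering-nonedge : ∀ {a b} → (a , b) ∈ ordering → toℕ a < toℕ b × adjacent a b ≡ false
  ordering-nonedge ab∈ with ∈-++⁻ phase₁ ab∈
  ... | inj₁ ab∈₁ = phase₁-nonedge (proj₂ (∈-filter⁻ inPhase₁? {xs = pairs} ab∈₁))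
  ... | inj₂ ab∈₂ = phase₂-nonedge (proj₂ (∈-filter⁻ inPhase₂? {xs = pairs} ab∈₂))

  ∈-pairs : ∀ a b → (a , b) ∈ pairs
  ∈-pairs a b = ∈-cartesianProduct⁺ (∈-allFin a) (∈-allFin b)

  ordering-complete : ∀ {a b} → toℕ a < toℕ b → adjacent a b ≡ false → (a , b) ∈ ordering
  ordering-complete {a} {b} a<b ab-nonedge with toℕ b <? s | toℕ a <? t | toℕ a <? s
  ... | yes b<s | _       | _       = contradiction ab-nonedge (not-¬ (adjacent-S (<-trans a<b b<s) b<s a≢b))
    where a≢b = λ a≡b → <⇒≢ a<b (cong toℕ a≡b)
  ... | no _    | yes a<t | _       = contradiction ab-nonedge (not-¬ (adjacent-T a<t a≢b))
    where a≢b = λ a≡b → <⇒≢ a<b (cong toℕ a≡b)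
  ... | no b≮s  | no a≮t  | yes a<s = ∈-++⁺ˡ (∈-filter⁺ inPhase₁? (∈-pairs a b) (≮⇒≥ a≮t , a<s , ≮⇒≥ b≮s))
  ... | no _    | no _    | no a≮s  = ∈-++⁺ʳ phase₁ (∈-filter⁺ inPhase₂? (∈-pairs a b) (≮⇒≥ a≮s , a<b))

  ordering-unique : Unique ordering
  ordering-unique = ++⁺ (filter⁺ inPhase₁? pairs-unique) (filter⁺ inPhase₂? pairs-unique) disjoint
    where
    pairs-unique = cartesianProduct⁺ (allFin⁺ n) (allFin⁺ n)
    disjoint : ∀ {p} → ¬ (p ∈ phase₁ × p ∈ phase₂)
    disjoint (p∈₁ , p∈₂) = <⇒≱ (proj₁ (proj₂ (proj₂ (∈-filter⁻ inPhase₁? {xs = pairs} p∈₁))))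
                               (proj₁ (proj₂ (∈-filter⁻ inPhase₂? {xs = pairs} p∈₂)))

  ordering-nonEdgeOrdering : NonEdgeOrdering construction ordering
  ordering-nonEdgeOrdering = ordering-unique , λ u v → ordering-nonedge , λ (u<v , nonedge) → ordering-complete u<v nonedge

  pairs-below-s pairs-from-T : Fin n → Fin n → ℕ
  pairs-below-s u v = 𝟙 ((toℕ u <ᵇ toℕ v) ∧ inS v)
  pairs-from-T  u v = 𝟙 (inT u) * 𝟙 (not (inS v))

  edge-split : ∀ u v → 𝟙 ((toℕ u <ᵇ toℕ v) ∧ adjacent u v) ≤ pairs-below-s u v + pairs-from-T u v
  edge-split u v with toℕ u <? toℕ v | toℕ v <? s | toℕ u <? t
  ... | no u≮v  | _       | _ rewrite dec-false (toℕ u <? toℕ v) u≮v = z≤n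
  ... | yes u<v | yes v<s | _
    rewrite dec-true (toℕ u <? toℕ v) u<v | dec-true (toℕ v <? s) v<s = ≤-trans (𝟙≤1 _) (m≤m+n 1 _)
  ... | yes u<v | no v≮s  | yes u<t
    rewrite dec-true (toℕ u <? toℕ v) u<v | dec-false (toℕ v <? s) v≮s | dec-true (toℕ u <? t) u<t = 𝟙≤1 _
  ... | yes u<v | no v≮s  | no u≮t
    rewrite dec-true (toℕ u <? toℕ v) u<v | nonadjacent {u} {v} (≮⇒≥ u≮t) (≮⇒≥ v≮s) = z≤n

  count-pairs-from-T : ∑[ u < n ] sum (pairs-from-T u) ≡ t * (n ∸ s)
  count-pairs-from-T = begin
    ∑[ u < n ] ∑[ v < n ] (𝟙 (inT u) * 𝟙 (not (inS v)))   ≡⟨ sum-cong-≗ {n} (λ u → *-distribˡ-sum (𝟙 (inT u)) (λ v → 𝟙 (not (inS v)))) ⟨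
    ∑[ u < n ] (𝟙 (inT u) * count (λ (v : Fin n) → ¬? (toℕ v <? s))) ≡⟨ sum-cong-≗ {n} (λ u → cong (𝟙 (inT u) *_) (count-≥ s s≤n)) ⟩
    ∑[ u < n ] (𝟙 (inT u) * (n ∸ s))                     ≡⟨ *-distribʳ-sum (n ∸ s) (λ u → 𝟙 (inT u)) ⟨
    count (λ (u : Fin n) → toℕ u <? t) * (n ∸ s)                    ≡⟨ cong (_* (n ∸ s)) (count-< t (≤-trans t≤s s≤n)) ⟩
    t * (n ∸ s)                                           ∎
    where open ≡-Reasoning

  eCount-construction : eCount construction ≤ s C 2 + t * (n ∸ s)
  eCount-construction = begin
    eCount construction                                                  ≡⟨ eCount≡∑ construction ⟩
    ∑[ u < n ] ∑[ v < n ] 𝟙 ((toℕ u <ᵇ toℕ v) ∧ adjacent u v)            ≤⟨ ∑-mono-≤ (λ u → ∑-mono-≤ (edge-split u)) ⟩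
    ∑[ u < n ] ∑[ v < n ] (pairs-below-s u v + pairs-from-T u v)         ≡⟨ sum-cong-≗ (λ u → ∑-distrib-+ (pairs-below-s u) (pairs-from-T u)) ⟩
    ∑[ u < n ] (sum (pairs-below-s u) + sum (pairs-from-T u))            ≡⟨ ∑-distrib-+ (sum ∘ pairs-below-s) (sum ∘ pairs-from-T) ⟩
    ∑[ u < n ] sum (pairs-below-s u) + ∑[ u < n ] sum (pairs-from-T u)   ≡⟨ cong₂ _+_ (count-pairs s s≤n) count-pairs-from-T ⟩
    s C 2 + t * (n ∸ s)                                                  ∎
    where open ≤-Reasoning

  -- The new colour c may already be the colour of an edge pq of the construction; a copy through
  -- ab must then miss an endpoint of pq other than a and b.
  module Avoid (a b : Fin n) (c : ℕ) (ab-nonedge : adjacent a b ≡ false) where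

    clash? : Dec (∃[ p ] ∃[ q ] (adjacent p q ≡ true × colour p q ≡ c))
    clash? = any? λ p → any? λ q → (adjacent p q Bool.≟ true) ×-dec (colour p q ℕ.≟ c)

    avoided : Fin n
    avoided with clash?
    ... | yes (p , q , _) = if ⌊ p ≟ a ⌋ ∨ ⌊ p ≟ b ⌋ then q else p
    ... | no _            = a

    avoided-spec : ∀ {p q} → adjacent p q ≡ true → colour p q ≡ c →
      avoided ≢ a × avoided ≢ b × (avoided ≡ p ⊎ avoided ≡ q)
    avoided-spec {p} {q} pq pq-colour with clash?
    ... | no none = contradiction (p , q , pq , pq-colour) none
    ... | yes (p₀ , q₀ , p₀q₀ , p₀q₀-colour) with colour-injective (trans p₀q₀-colour (sym pq-colour)) | p₀ ≟ a | p₀ ≟ b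
    ...   | same | yes refl | _        =
      adj⇒≢ construction p₀q₀ ∘ sym , (λ q₀≡b → not-¬ (subst (λ y → adjacent a y ≡ true) q₀≡b p₀q₀) ab-nonedge) , SameEdge-snd same
    ...   | same | no _     | yes refl =
      (λ q₀≡a → not-¬ (trans (adjacent-sym a b) (subst (λ y → adjacent b y ≡ true) q₀≡a p₀q₀)) ab-nonedge) , adj⇒≢ construction p₀q₀ ∘ sym , SameEdge-snd same
    ...   | same | no p₀≢a  | no p₀≢b  = p₀≢a , p₀≢b , SameEdge-fst same

  -- z ↦ b and x ↦ a; the other neighbours of z go to T ∖ {w}, which is joined to b, and its
  -- non-neighbours to S ∖ (T ∪ {a, w}). deg-fits and order-fits say that there is room.
  module Phase₁Embedding {k : ℕ} (H : Graph k) (z x : Fin k) (zx : adj H z x ≡ true)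
    (deg-fits : deg H z ∸ 1 ≤ t ∸ 1) (order-fits : k + 1 ≤ s ∸ t + deg H z)
    (a b : Fin n) (t≤a : t ≤ toℕ a) (a<s : toℕ a < s) (s≤b : s ≤ toℕ b) (w : Fin n) where

    neighbours : List (Fin k)
    neighbours = filterᵇ (adj H z) (allFin k)

    otherNeighbours? : Decidable (λ u → adj H z u ≡ true × u ≢ x)
    otherNeighbours? u = (adj H z u Bool.≟ true) ×-dec ¬? (u ≟ x)

    nonNeighbours? : Decidable (λ u → adj H z u ≡ false × u ≢ z)
    nonNeighbours? u = (adj H z u Bool.≟ false) ×-dec ¬? (u ≟ z)

    lowSlots? : Decidable (λ v → toℕ v < t × v ≢ w)
    lowSlots? v = toℕ v <? t ×-dec ¬? (v ≟ w)

    middleSlots? : Decidable (λ v → (t ≤ toℕ v × toℕ v < s) × v ≢ a × v ≢ w)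
    middleSlots? v = (t ≤? toℕ v ×-dec toℕ v <? s) ×-dec ¬? (v ≟ a) ×-dec ¬? (v ≟ w)

    otherNeighbours nonNeighbours : List (Fin k)
    otherNeighbours = filter otherNeighbours? (allFin k)
    nonNeighbours   = filter nonNeighbours? (allFin k)

    lowSlots middleSlots : List (Fin n)
    lowSlots    = filter lowSlots? (allFin n)
    middleSlots = filter middleSlots? (allFin n)

    otherNeighbours<deg : length otherNeighbours < deg H z
    otherNeighbours<deg = length-<-injectiveOn (λ u → u) (filter⁺ otherNeighbours? (allFin⁺ k))
      (λ u∈ → ∈-neighbours⁺ H (proj₁ (proj₂ (∈-filter⁻ otherNeighbours? {xs = allFin k} u∈))))
      (λ _ _ eq → eq) (∈-neighbours⁺ H zx)
      (λ u∈ → proj₂ (proj₂ (∈-filter⁻ otherNeighbours? {xs = allFin k} u∈)))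

    t≤lowSlots+1 : t ≤ length lowSlots + 1
    t≤lowSlots+1 = begin
      t                                            ≡⟨ count-< t (≤-trans t≤s s≤n) ⟨
      count (λ (v : Fin n) → toℕ v <? t)           ≤⟨ count-∪ (λ v → toℕ v <? t) lowSlots? (_≟ w) split ⟩
      count lowSlots? + count (_≟ w)               ≤⟨ +-mono-≤ (≤-reflexive (sym (length-filter-tabulate lowSlots? (λ v → v)))) (count-≡ w) ⟩
      length lowSlots + 1                          ∎
      where
      open ≤-Reasoning
      split : ∀ {v} → toℕ v < t → (toℕ v < t × v ≢ w) ⊎ v ≡ w
      split {v} v<t with v ≟ w
      ... | yes v≡w = inj₂ v≡w
      ... | no v≢w  = inj₁ (v<t , v≢w)

    otherNeighbours-fit : length otherNeighbours ≤ length lowSlots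
    otherNeighbours-fit = begin
      length otherNeighbours             ≡⟨ m+n∸n≡m (length otherNeighbours) 1 ⟨
      length otherNeighbours + 1 ∸ 1     ≡⟨ cong (_∸ 1) (+-comm (length otherNeighbours) 1) ⟩
      suc (length otherNeighbours) ∸ 1   ≤⟨ ∸-monoˡ-≤ 1 otherNeighbours<deg ⟩
      deg H z ∸ 1                        ≤⟨ deg-fits ⟩
      t ∸ 1                              ≤⟨ ∸-monoˡ-≤ 1 t≤lowSlots+1 ⟩
      length lowSlots + 1 ∸ 1            ≡⟨ m+n∸n≡m (length lowSlots) 1 ⟩
      length lowSlots                    ∎
      where open ≤-Reasoning

    order-bound : suc (deg H z + length nonNeighbours) ≤ k
    order-bound = begin
      suc (deg H z + length nonNeighbours)        ≡⟨ cong suc (length-++ neighbours) ⟨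
      length (z ∷ neighbours ++ nonNeighbours)    ≤⟨ length-≤-⊆ distinct (λ _ → ∈-allFin _) ⟩
      length (allFin k)                           ≡⟨ length-tabulate {n = k} (λ u → u) ⟩
      k                                           ∎
      where
      open ≤-Reasoning
      in-nonNeighbours : ∀ {u} → u ∈ nonNeighbours → adj H z u ≡ false × u ≢ z
      in-nonNeighbours u∈ = proj₂ (∈-filter⁻ nonNeighbours? {xs = allFin k} u∈)
      z∉ : ∀ {u} → u ∈ neighbours ++ nonNeighbours → z ≢ u
      z∉ u∈ refl with ∈-++⁻ neighbours u∈
      ... | inj₁ z∈N  = not-¬ (∈-neighbours⁻ H z∈N) (irrefl H z)
      ... | inj₂ z∈nN = proj₂ (in-nonNeighbours z∈nN) refl
      distinct : Unique (z ∷ neighbours ++ nonNeighbours)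
      distinct = All.tabulate z∉ ∷ ++⁺ (filter⁺ (T? ∘ adj H z) (allFin⁺ k)) (filter⁺ nonNeighbours? (allFin⁺ k))
        (λ (u∈N , u∈nN) → not-¬ (∈-neighbours⁻ H u∈N) (proj₁ (in-nonNeighbours u∈nN)))

    s∸t≤middleSlots+2 : s ∸ t ≤ length middleSlots + 2
    s∸t≤middleSlots+2 = begin
      s ∸ t                                                      ≡⟨ count-between t s t≤s s≤n ⟨
      count (λ (v : Fin n) → t ≤? toℕ v ×-dec toℕ v <? s)        ≤⟨ count-∪ (λ v → t ≤? toℕ v ×-dec toℕ v <? s) middleSlots? a-or-w? split ⟩
      count middleSlots? + count a-or-w?                         ≤⟨ +-mono-≤ (≤-reflexive (sym (length-filter-tabulate middleSlots? (λ v → v))))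
                                                                              (≤-trans (count-∪ a-or-w? (_≟ a) (_≟ w) (λ a∨w → a∨w)) (+-mono-≤ (count-≡ a) (count-≡ w))) ⟩
      length middleSlots + 2                                     ∎
      where
      open ≤-Reasoning
      a-or-w? : Decidable (λ v → v ≡ a ⊎ v ≡ w)
      a-or-w? v = v ≟ a ⊎-dec v ≟ w
      split : ∀ {v} → t ≤ toℕ v × toℕ v < s → ((t ≤ toℕ v × toℕ v < s) × v ≢ a × v ≢ w) ⊎ (v ≡ a ⊎ v ≡ w)
      split {v} between with v ≟ a | v ≟ w
      ... | yes v≡a | _       = inj₂ (inj₁ v≡a)
      ... | no _    | yes v≡w = inj₂ (inj₂ v≡w)
      ... | no v≢a  | no v≢w  = inj₁ (between , v≢a , v≢w)

    nonNeighbours-fit : length nonNeighbours ≤ length middleSlots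
    nonNeighbours-fit = +-cancelʳ-≤ (2 + deg H z) (length nonNeighbours) (length middleSlots) (begin
      length nonNeighbours + (2 + deg H z)   ≡⟨ rearrange (length nonNeighbours) (deg H z) ⟩
      suc (deg H z + length nonNeighbours) + 1 ≤⟨ +-monoˡ-≤ 1 order-bound ⟩
      k + 1                                  ≤⟨ order-fits ⟩
      s ∸ t + deg H z                        ≤⟨ +-monoˡ-≤ (deg H z) s∸t≤middleSlots+2 ⟩
      length middleSlots + 2 + deg H z       ≡⟨ +-assoc (length middleSlots) 2 (deg H z) ⟩
      length middleSlots + (2 + deg H z)     ∎)
      where
      open ≤-Reasoning
      rearrange : ∀ m d → m + (2 + d) ≡ suc (d + m) + 1
      rearrange = solve-∀

    sources : List (Fin k)
    sources = z ∷ x ∷ otherNeighbours ++ nonNeighbours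

    targets : List (Fin n)
    targets = b ∷ a ∷ take (length otherNeighbours) lowSlots ++ middleSlots

    length-lowTargets : length (take (length otherNeighbours) lowSlots) ≡ length otherNeighbours
    length-lowTargets = trans (length-take _ lowSlots) (m≤n⇒m⊓n≡m otherNeighbours-fit)

    sources-fit : length sources ≤ length targets
    sources-fit = s≤s (s≤s (begin
      length (otherNeighbours ++ nonNeighbours)                                ≡⟨ length-++ otherNeighbours ⟩
      length otherNeighbours + length nonNeighbours                            ≤⟨ +-mono-≤ (≤-reflexive (sym length-lowTargets)) nonNeighbours-fit ⟩
      length (take (length otherNeighbours) lowSlots) + length middleSlots     ≡⟨ length-++ (take (length otherNeighbours) lowSlots) ⟨
      length (take (length otherNeighbours) lowSlots ++ middleSlots)           ∎))
      where open ≤-Reasoning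

    sources-cover : ∀ u → u ∈ sources
    sources-cover u with u ≟ z | u ≟ x | adj H z u Bool.≟ true
    ... | yes refl | _        | _     = here refl
    ... | no _     | yes refl | _     = there (here refl)
    ... | no _     | no u≢x   | yes zu = there (there (∈-++⁺ˡ (∈-filter⁺ otherNeighbours? (∈-allFin u) (zu , u≢x))))
    ... | no u≢z   | no _     | no ¬zu = there (there (∈-++⁺ʳ otherNeighbours (∈-filter⁺ nonNeighbours? (∈-allFin u) (Bool.¬-not ¬zu , u≢z))))

    data Placement (u : Fin k) (v : Fin n) : Set where
      centre        : u ≡ z → v ≡ b → Placement u v
      partner       : u ≡ x → v ≡ a → Placement u v
      low           : u ∈ otherNeighbours → v ∈ lowSlots → Placement u v
      middle        : u ∈ nonNeighbours → v ∈ middleSlots → Placement u v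

    placement : ∀ {u v} → (u , v) ∈ zip sources targets → Placement u v
    placement (here refl)         = centre refl refl
    placement (there (here refl)) = partner refl refl
    placement (there (there p)) with ∈-zip-++⁻ (sym length-lowTargets) p
    ... | inj₁ (u∈ , v∈) = low u∈ (∈-take⁻ v∈)
    ... | inj₂ (u∈ , v∈) = middle u∈ v∈

    in-otherNeighbours : ∀ {u} → u ∈ otherNeighbours → adj H z u ≡ true × u ≢ x
    in-otherNeighbours u∈ = proj₂ (∈-filter⁻ otherNeighbours? {xs = allFin k} u∈)

    in-nonNeighbours : ∀ {u} → u ∈ nonNeighbours → adj H z u ≡ false × u ≢ z
    in-nonNeighbours u∈ = proj₂ (∈-filter⁻ nonNeighbours? {xs = allFin k} u∈)

    in-lowSlots : ∀ {v} → v ∈ lowSlots → toℕ v < t × v ≢ w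
    in-lowSlots v∈ = proj₂ (∈-filter⁻ lowSlots? {xs = allFin n} v∈)

    in-middleSlots : ∀ {v} → v ∈ middleSlots → (t ≤ toℕ v × toℕ v < s) × v ≢ a × v ≢ w
    in-middleSlots v∈ = proj₂ (∈-filter⁻ middleSlots? {xs = allFin n} v∈)

    targets-unique : Unique targets
    targets-unique = All.tabulate b∉ ∷ All.tabulate a∉ ∷
      ++⁺ (take⁺ _ (filter⁺ lowSlots? (allFin⁺ n))) (filter⁺ middleSlots? (allFin⁺ n))
          (λ (v∈low , v∈mid) → <⇒≱ (proj₁ (in-lowSlots (∈-take⁻ v∈low))) (proj₁ (proj₁ (in-middleSlots v∈mid))))
      where
      in-S : ∀ {v} → v ∈ take (length otherNeighbours) lowSlots ++ middleSlots → toℕ v < s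
      in-S v∈ with ∈-++⁻ (take (length otherNeighbours) lowSlots) v∈
      ... | inj₁ v∈low = <-≤-trans (proj₁ (in-lowSlots (∈-take⁻ v∈low))) t≤s
      ... | inj₂ v∈mid = proj₂ (proj₁ (in-middleSlots v∈mid))
      b∉ : ∀ {v} → v ∈ a ∷ take (length otherNeighbours) lowSlots ++ middleSlots → b ≢ v
      b∉ (here refl) refl = <⇒≱ a<s s≤b
      b∉ (there v∈)  refl = <⇒≱ (in-S v∈) s≤b
      a∉ : ∀ {v} → v ∈ take (length otherNeighbours) lowSlots ++ middleSlots → a ≢ v
      a∉ v∈ refl with ∈-++⁻ (take (length otherNeighbours) lowSlots) v∈
      ... | inj₁ a∈low = <⇒≱ (proj₁ (in-lowSlots (∈-take⁻ a∈low))) t≤a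
      ... | inj₂ a∈mid = proj₁ (proj₂ (in-middleSlots a∈mid)) refl

    opaque
      φ : Fin k → Fin n
      φ u = proj₁ (∈-zip-partner {ys = targets} (sources-cover u) sources-fit)

      φ-∈ : ∀ u → (u , φ u) ∈ zip sources targets
      φ-∈ u = proj₂ (∈-zip-partner {ys = targets} (sources-cover u) sources-fit)

    φ-placement : ∀ u → Placement u (φ u)
    φ-placement u = placement (φ-∈ u)

    φ-injective : ∀ {u v} → φ u ≡ φ v → u ≡ v
    φ-injective {u} {v} eq = ∈-zip-injective {xs = sources} targets-unique (φ-∈ u) (subst (λ y → (v , y) ∈ zip sources targets) (sym eq) (φ-∈ v))

    z≢x : z ≢ x
    z≢x = adj⇒≢ H zx

    φ-centre : φ z ≡ b
    φ-centre with φ-placement z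
    ... | centre _ φz≡b = φz≡b
    ... | partner z≡x _ = contradiction z≡x z≢x
    ... | low z∈ _      = contradiction (proj₁ (in-otherNeighbours z∈)) (not-¬ (irrefl H z))
    ... | middle z∈ _   = contradiction refl (proj₂ (in-nonNeighbours z∈))

    φ-partner : φ x ≡ a
    φ-partner with φ-placement x
    ... | centre x≡z _  = contradiction (sym x≡z) z≢x
    ... | partner _ φx≡a = φx≡a
    ... | low x∈ _      = contradiction refl (proj₂ (in-otherNeighbours x∈))
    ... | middle x∈ _   = contradiction zx (not-¬ (proj₁ (in-nonNeighbours x∈)))

    φ-in-S : ∀ {u} → u ≢ z → toℕ (φ u) < s
    φ-in-S {u} u≢z with φ-placement u
    ... | centre u≡z _   = contradiction u≡z u≢z
    ... | partner _ φu≡a = subst (λ y → toℕ y < s) (sym φu≡a) a<s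
    ... | low _ v∈       = <-≤-trans (proj₁ (in-lowSlots v∈)) t≤s
    ... | middle _ v∈    = proj₂ (proj₁ (in-middleSlots v∈))

    φ-in-T : ∀ {u} → adj H z u ≡ true → u ≢ x → toℕ (φ u) < t
    φ-in-T {u} zu u≢x with φ-placement u
    ... | centre refl _  = contradiction zu (not-¬ (irrefl H z))
    ... | partner u≡x _  = contradiction u≡x u≢x
    ... | low _ v∈       = proj₁ (in-lowSlots v∈)
    ... | middle u∈ _    = contradiction zu (not-¬ (proj₁ (in-nonNeighbours u∈)))

    φ-avoids : ∀ {u} → u ≢ z → u ≢ x → φ u ≢ w
    φ-avoids {u} u≢z u≢x with φ-placement u
    ... | centre u≡z _  = contradiction u≡z u≢z
    ... | partner u≡x _ = contradiction u≡x u≢x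
    ... | low _ v∈      = proj₂ (in-lowSlots v∈)
    ... | middle _ v∈   = proj₂ (proj₂ (in-middleSlots v∈))

    φ-edge : ∀ {u v} → adj H u v ≡ true → SameEdge u v z x ⊎ adjacent (φ u) (φ v) ≡ true
    φ-edge {u} {v} uv with u ≟ z | v ≟ z
    ... | yes u≡z | yes v≡z = contradiction (trans u≡z (sym v≡z)) (adj⇒≢ H uv)
    ... | yes u≡z | no v≢z with v ≟ x
    ...   | yes v≡x = inj₁ (inj₁ (u≡z , v≡x))
    ...   | no v≢x  = inj₂ (trans (adjacent-sym (φ u) (φ v))
                      (adjacent-T (φ-in-T (subst (λ y → adj H y v ≡ true) u≡z uv) v≢x) (λ φv≡φu → v≢z (trans (φ-injective φv≡φu) u≡z))))
    φ-edge {u} {v} uv | no u≢z | yes v≡z with u ≟ x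
    ...   | yes u≡x = inj₁ (inj₂ (u≡x , v≡z))
    ...   | no u≢x  = inj₂ (adjacent-T (φ-in-T (subst (λ y → adj H y u ≡ true) v≡z (trans (adj-sym H v u) uv)) u≢x)
                      (λ φu≡φv → u≢z (trans (φ-injective φu≡φv) v≡z)))
    φ-edge {u} {v} uv | no u≢z | no v≢z =
      inj₂ (adjacent-S (φ-in-S u≢z) (φ-in-S v≢z) (adj⇒≢ H uv ∘ φ-injective))

  module AfterAdding {k : ℕ} (H : Graph k) (cs : List ℕ) (cs-unique : Unique cs)
    (pre : List (Entry n)) (a b : Fin n) (c : ℕ)
    (es⊆zip : ∀ {ec} → ec ∈ pre ++ [ ((a , b) , c) ] → ec ∈ zip ordering cs) where

    private
      es : List (Entry n)
      es = pre ++ [ ((a , b) , c) ]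

    open RainbowAssembly adjacent colour adjacent-sym colour-injective ordering (proj₂ ∘ ordering-nonedge) cs cs-unique es es⊆zip

    new-edge : stA a b ≡ true × stC a b ≡ c
    new-edge = addEdges-last (adjacent , colour) pre a b c

    new-edge-sym : stA b a ≡ true × stC b a ≡ c
    new-edge-sym = trans (addEdges-adj-sym (adjacent , colour) es adjacent-sym b a) (proj₁ new-edge) ,
                   trans (addEdges-col-sym (adjacent , colour) es colour-sym b a) (proj₂ new-edge)

    phase₁-copy : (z x : Fin k) → adj H z x ≡ true → deg H z ∸ 1 ≤ t ∸ 1 → k + 1 ≤ s ∸ t + deg H z →
      InPhase₁ (a , b) → RainbowCopyContaining H (addEdges (adjacent , colour) es) (a , b)
    phase₁-copy z x zx deg-fits order-fits (t≤a , a<s , s≤b) =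
      rainbowCopy {H = H} φ φ-injective edges separated (x , z , trans (adj-sym H x z) zx , φ-partner , φ-centre)
      where
      open Avoid a b c (nonadjacent t≤a s≤b)
      open Phase₁Embedding H z x zx deg-fits order-fits a b t≤a a<s s≤b avoided

      new-edge-copied : ∀ {u v} → SameEdge u v z x → stA (φ u) (φ v) ≡ true × stC (φ u) (φ v) ≡ c
      new-edge-copied (inj₁ (refl , refl)) = subst₂ (λ p q → stA p q ≡ true × stC p q ≡ c) (sym φ-centre) (sym φ-partner) new-edge-sym
      new-edge-copied (inj₂ (refl , refl)) = subst₂ (λ p q → stA p q ≡ true × stC p q ≡ c) (sym φ-partner) (sym φ-centre) new-edge

      edges : ∀ u v → adj H u v ≡ true → stA (φ u) (φ v) ≡ true
      edges u v uv with φ-edge uv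
      ... | inj₁ zx-pair = proj₁ (new-edge-copied zx-pair)
      ... | inj₂ φuv     = addEdges-adj-mono (adjacent , colour) es φuv

      φ-misses-avoided : avoided ≢ a → avoided ≢ b → ∀ u → φ u ≢ avoided
      φ-misses-avoided w≢a w≢b u with u ≟ z | u ≟ x
      ... | yes refl | _        = λ φz≡w → w≢b (trans (sym φz≡w) φ-centre)
      ... | no _     | yes refl = λ φx≡w → w≢a (trans (sym φx≡w) φ-partner)
      ... | no u≢z   | no u≢x   = φ-avoids u≢z u≢x

      separated : ∀ {u v u′ v′} → adj H u v ≡ true → adj H u′ v′ ≡ true →
        adjacent (φ u) (φ v) ≡ true → adjacent (φ u′) (φ v′) ≡ false → colour (φ u) (φ v) ≢ stC (φ u′) (φ v′)
      separated {u} {v} _ u′v′ φuv ¬φu′v′ same with φ-edge u′v′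
      ... | inj₂ φu′v′   = not-¬ φu′v′ ¬φu′v′
      ... | inj₁ zx-pair with avoided-spec φuv (trans same (proj₂ (new-edge-copied zx-pair)))
      ...   | w≢a , w≢b , inj₁ w≡φu = φ-misses-avoided w≢a w≢b u (sym w≡φu)
      ...   | w≢a , w≢b , inj₂ w≡φv = φ-misses-avoided w≢a w≢b v (sym w≡φv)

    -- ι places f vertices inside S ∖ T. Every pair from a or b to them was added in phase 1, so
    -- the residual graph, which drops the pairs whose colour clashes with one of these 2f + 1 new
    -- edges, still has more than ex(f, ℋ) edges and contains H − {x₁, y₁}; x₁ and y₁ go to a and b.
    module Phase₂ (f : ℕ) (FP : FProp H f) (t+f≤s : t + f ≤ s) (default : Fin f)
      (phase₁-added : ∀ {p} → p ∈ phase₁ → ∃[ c′ ] (p , c′) ∈ pre ++ [ ((a , b) , c) ])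
      (s≤a : s ≤ toℕ a) (a<b : toℕ a < toℕ b) where

      ι-bound : ∀ (j : Fin f) → t + toℕ j < n
      ι-bound j = <-≤-trans (+-monoʳ-< t (toℕ<n j)) (≤-trans t+f≤s s≤n)

      ι : Fin f → Fin n
      ι j = fromℕ< (ι-bound j)

      toℕ-ι : ∀ j → toℕ (ι j) ≡ t + toℕ j
      toℕ-ι j = toℕ-fromℕ< (ι-bound j)

      ι-injective : ∀ {i j} → ι i ≡ ι j → i ≡ j
      ι-injective {i} {j} eq = toℕ-injective (+-cancelˡ-≡ t _ _ (trans (sym (toℕ-ι i)) (trans (cong toℕ eq) (toℕ-ι j))))

      ι-in-S : ∀ j → toℕ (ι j) < s
      ι-in-S j = subst (_< s) (sym (toℕ-ι j)) (<-≤-trans (+-monoʳ-< t (toℕ<n j)) t+f≤s)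

      ι-above-T : ∀ j → t ≤ toℕ (ι j)
      ι-above-T j = subst (t ≤_) (sym (toℕ-ι j)) (m≤m+n t (toℕ j))

      used : List ℕ
      used = c ∷ map (stC a ∘ ι) (allFin f) ++ map (stC b ∘ ι) (allFin f)

      length-used : length used ≡ suc (f + f)
      length-used = cong suc (trans (length-++ (map (stC a ∘ ι) (allFin f)))
        (cong₂ _+_ (trans (length-map _ (allFin f)) (length-tabulate {n = f} (λ j → j)))
                   (trans (length-map _ (allFin f)) (length-tabulate {n = f} (λ j → j)))))

      a-colour-used : ∀ j → stC a (ι j) ∈ used
      a-colour-used j = there (∈-++⁺ˡ (∈-map⁺ (stC a ∘ ι) (∈-allFin j)))

      b-colour-used : ∀ j → stC b (ι j) ∈ used
      b-colour-used j = there (∈-++⁺ʳ (map (stC a ∘ ι) (allFin f)) (∈-map⁺ (stC b ∘ ι) (∈-allFin j)))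

      fresh : Fin f → Fin f → Bool
      fresh u v = not (does (u ≟ v)) ∧ not (does (colour (ι u) (ι v) ∈? used))

      residual : Graph f
      residual = record
        { adj    = fresh
        ; sym    = λ u v → cong₂ (λ p q → not p ∧ not (does (q ∈? used))) (≟-sym u v) (colour-sym (ι u) (ι v))
        ; irrefl = λ u → cong (λ p → not p ∧ not (does (colour (ι u) (ι u) ∈? used))) (dec-true (u ≟ u) refl)
        }

      fresh⁻ : ∀ {i j} → fresh i j ≡ true → i ≢ j × colour (ι i) (ι j) ∉ used
      fresh⁻ {i} {j} eq = not-does⇒¬ (i ≟ j) (∧-conicalˡ _ _ eq) , not-does⇒¬ (colour (ι i) (ι j) ∈? used) (∧-conicalʳ _ _ eq)

      Clashing : Fin f × Fin f → Set
      Clashing (u , v) = toℕ u < toℕ v × colour (ι u) (ι v) ∈ used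

      clashing? : Decidable Clashing
      clashing? (u , v) = toℕ u <? toℕ v ×-dec colour (ι u) (ι v) ∈? used

      clashing : List (Fin f × Fin f)
      clashing = filter clashing? (cartesianProduct (allFin f) (allFin f))

      in-clashing : ∀ {p} → p ∈ clashing → Clashing p
      in-clashing p∈ = proj₂ (∈-filter⁻ clashing? {xs = cartesianProduct (allFin f) (allFin f)} p∈)

      clashing≤used : length clashing ≤ length used
      clashing≤used = length-≤-injectiveOn (λ (u , v) → colour (ι u) (ι v))
        (filter⁺ clashing? (cartesianProduct⁺ (allFin⁺ f) (allFin⁺ f))) (proj₂ ∘ in-clashing) injective
        where
        injective : ∀ {p q} → p ∈ clashing → q ∈ clashing →
          colour (ι (proj₁ p)) (ι (proj₂ p)) ≡ colour (ι (proj₁ q)) (ι (proj₂ q)) → p ≡ q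
        injective {u , v} {u′ , v′} p∈ q∈ eq with colour-injective eq
        ... | inj₁ (u≡u′ , v≡v′) = cong₂ _,_ (ι-injective u≡u′) (ι-injective v≡v′)
        ... | inj₂ (u≡v′ , v≡u′) = contradiction (proj₁ (in-clashing q∈))
            (<⇒≯ (subst₂ (λ p q → toℕ p < toℕ q) (ι-injective u≡v′) (ι-injective v≡u′) (proj₁ (in-clashing p∈))))

      residual-dense : f C 2 ≤ eCount residual + 2 * f + 1
      residual-dense = begin
        f C 2                                                                    ≡⟨ count-pairs f ≤-refl ⟨
        ∑[ u < f ] ∑[ v < f ] 𝟙 ((toℕ u <ᵇ toℕ v) ∧ (toℕ v <ᵇ f))                ≤⟨ ∑-mono-≤ (λ u → ∑-mono-≤ (split u)) ⟩
        ∑[ u < f ] ∑[ v < f ] (𝟙 ((toℕ u <ᵇ toℕ v) ∧ fresh u v) + clash u v)     ≡⟨ sum-cong-≗ {f} (λ u → ∑-distrib-+ (λ v → 𝟙 ((toℕ u <ᵇ toℕ v) ∧ fresh u v)) (clash u)) ⟩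
        ∑[ u < f ] (∑[ v < f ] 𝟙 ((toℕ u <ᵇ toℕ v) ∧ fresh u v) + sum (clash u)) ≡⟨ ∑-distrib-+ (λ u → ∑[ v < f ] 𝟙 ((toℕ u <ᵇ toℕ v) ∧ fresh u v)) (sum ∘ clash) ⟩
        ∑[ u < f ] ∑[ v < f ] 𝟙 ((toℕ u <ᵇ toℕ v) ∧ fresh u v) + ∑[ u < f ] sum (clash u)
          ≡⟨ cong₂ _+_ (eCount≡∑ residual) (length-filter-cartesianProduct clashing? (λ j → j) (λ j → j)) ⟨
        eCount residual + length clashing                                        ≤⟨ +-monoʳ-≤ (eCount residual) (≤-trans clashing≤used (≤-reflexive length-used)) ⟩
        eCount residual + suc (f + f)                                            ≡⟨ rearrange (eCount residual) f ⟩
        eCount residual + 2 * f + 1                                              ∎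
        where
        open ≤-Reasoning
        clash : Fin f → Fin f → ℕ
        clash u v = 𝟙 (does (clashing? (u , v)))
        rearrange : ∀ e f → e + suc (f + f) ≡ e + 2 * f + 1
        rearrange = solve-∀
        split : ∀ u v → 𝟙 ((toℕ u <ᵇ toℕ v) ∧ (toℕ v <ᵇ f)) ≤ 𝟙 ((toℕ u <ᵇ toℕ v) ∧ fresh u v) + clash u v
        split u v with toℕ u <? toℕ v
        ... | no u≮v rewrite dec-false (toℕ u <? toℕ v) u≮v = z≤n
        ... | yes u<v rewrite dec-true (toℕ u <? toℕ v) u<v | dec-false (u ≟ v) (λ u≡v → <⇒≢ u<v (cong toℕ u≡v))
          with does (colour (ι u) (ι v) ∈? used)
        ... | true  = ≤-trans (𝟙≤1 _) ≤-refl
        ... | false = ≤-trans (𝟙≤1 _) ≤-refl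

      opaque
        copy : ∃[ x₁ ] ∃[ y₁ ] (adj H x₁ y₁ ≡ true × ∃ (TotalCopyOfDel H x₁ y₁ residual))
        copy = dense⇒copy {H = H} FP default residual residual-dense

      private
        x₁ y₁ : Fin k
        x₁ = proj₁ copy
        y₁ = proj₁ (proj₂ copy)

        x₁y₁ : adj H x₁ y₁ ≡ true
        x₁y₁ = proj₁ (proj₂ (proj₂ copy))

        ψ : Fin k → Fin f
        ψ = proj₁ (proj₂ (proj₂ (proj₂ copy)))

        ψ-copy : TotalCopyOfDel H x₁ y₁ residual ψ
        ψ-copy = proj₂ (proj₂ (proj₂ (proj₂ copy)))

      data Role (u : Fin k) : Set where
        first  : u ≡ x₁ → Role u
        second : u ≡ y₁ → Role u
        other  : u ≢ x₁ → u ≢ y₁ → Role u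

      role : ∀ u → Role u
      role u with u ≟ x₁ | u ≟ y₁
      ... | yes u≡x₁ | _        = first u≡x₁
      ... | no _     | yes u≡y₁ = second u≡y₁
      ... | no u≢x₁  | no u≢y₁  = other u≢x₁ u≢y₁

      place : ∀ u → Role u → Fin n
      place u (first _)   = a
      place u (second _)  = b
      place u (other _ _) = ι (ψ u)

      φ : Fin k → Fin n
      φ u = place u (role u)

      a≢b : a ≢ b
      a≢b a≡b = <⇒≢ a<b (cong toℕ a≡b)

      outside-S≢ι : ∀ {q} j → s ≤ toℕ q → q ≢ ι j
      outside-S≢ι j s≤q q≡ιj = <⇒≱ (ι-in-S j) (subst (λ y → s ≤ toℕ y) q≡ιj s≤q)

      s≤b : s ≤ toℕ b
      s≤b = ≤-trans s≤a (<⇒≤ a<b)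

      φ-injective : ∀ {u v} → φ u ≡ φ v → u ≡ v
      φ-injective {u} {v} eq with role u | role v
      ... | first refl    | first refl    = refl
      ... | second refl   | second refl   = refl
      ... | first _       | second _      = contradiction eq a≢b
      ... | second _      | first _       = contradiction (sym eq) a≢b
      ... | first _       | other _ _     = contradiction eq (outside-S≢ι (ψ v) s≤a)
      ... | other _ _     | first _       = contradiction (sym eq) (outside-S≢ι (ψ u) s≤a)
      ... | second _      | other _ _     = contradiction eq (outside-S≢ι (ψ v) s≤b)
      ... | other _ _     | second _      = contradiction (sym eq) (outside-S≢ι (ψ u) s≤b)
      ... | other u≢x₁ u≢y₁ | other v≢x₁ v≢y₁ = proj₁ ψ-copy u v u≢x₁ u≢y₁ v≢x₁ v≢y₁ (ι-injective eq)

      EdgeInfo : Fin n → Fin n → Set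
      EdgeInfo p q = (adjacent p q ≡ true × colour p q ∉ used) ⊎ (adjacent p q ≡ false × stC p q ∈ used × stA p q ≡ true)

      EdgeInfo-sym : ∀ {p q} → EdgeInfo p q → EdgeInfo q p
      EdgeInfo-sym {p} {q} (inj₁ (pq , fresh-colour)) =
        inj₁ (trans (adjacent-sym q p) pq , subst (_∉ used) (colour-sym p q) fresh-colour)
      EdgeInfo-sym {p} {q} (inj₂ (¬pq , used-colour , state-pq)) =
        inj₂ (trans (adjacent-sym q p) ¬pq , subst (_∈ used) (addEdges-col-sym (adjacent , colour) es colour-sym p q) used-colour ,
              trans (addEdges-adj-sym (adjacent , colour) es adjacent-sym q p) state-pq)

      new-edge-info : EdgeInfo a b
      new-edge-info = inj₂ (nonadjacent (≤-trans t≤s s≤a) s≤b , subst (_∈ used) (sym (proj₂ new-edge)) (here refl) , proj₁ new-edge)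

      phase₁-edge-info : ∀ {q} j → s ≤ toℕ q → stC q (ι j) ∈ used → EdgeInfo q (ι j)
      phase₁-edge-info {q} j s≤q used-colour with phase₁-added (∈-filter⁺ inPhase₁? (∈-pairs (ι j) q) (ι-above-T j , ι-in-S j , s≤q))
      ... | c′ , added = inj₂ (trans (adjacent-sym q (ι j)) (nonadjacent (ι-above-T j) s≤q) , used-colour ,
                              trans (addEdges-adj-sym (adjacent , colour) es adjacent-sym q (ι j))
                                    (addEdges-adj-∈ (adjacent , colour) es added (samePair-refl (ι j) q)))

      edge-info : ∀ {u v} → adj H u v ≡ true → EdgeInfo (φ u) (φ v)
      edge-info {u} {v} uv with role u | role v
      ... | first u≡x₁  | first v≡x₁  = contradiction (trans u≡x₁ (sym v≡x₁)) (adj⇒≢ H uv)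
      ... | second u≡y₁ | second v≡y₁ = contradiction (trans u≡y₁ (sym v≡y₁)) (adj⇒≢ H uv)
      ... | first _     | second _    = new-edge-info
      ... | second _    | first _     = EdgeInfo-sym new-edge-info
      ... | first _     | other _ _   = phase₁-edge-info (ψ v) s≤a (a-colour-used (ψ v))
      ... | other _ _   | first _     = EdgeInfo-sym (phase₁-edge-info (ψ u) s≤a (a-colour-used (ψ u)))
      ... | second _    | other _ _   = phase₁-edge-info (ψ v) s≤b (b-colour-used (ψ v))
      ... | other _ _   | second _    = EdgeInfo-sym (phase₁-edge-info (ψ u) s≤b (b-colour-used (ψ u)))
      ... | other u≢x₁ u≢y₁ | other v≢x₁ v≢y₁ with fresh⁻ (proj₂ ψ-copy u v u≢x₁ u≢y₁ v≢x₁ v≢y₁ uv)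
      ...   | ψu≢ψv , fresh-colour = inj₁ (adjacent-S (ι-in-S (ψ u)) (ι-in-S (ψ v)) (ψu≢ψv ∘ ι-injective) , fresh-colour)

      x₁≢y₁ : x₁ ≢ y₁
      x₁≢y₁ = adj⇒≢ H x₁y₁

      φ-x₁ : φ x₁ ≡ a
      φ-x₁ with role x₁
      ... | first _        = refl
      ... | second x₁≡y₁   = contradiction x₁≡y₁ x₁≢y₁
      ... | other x₁≢x₁ _  = contradiction refl x₁≢x₁

      φ-y₁ : φ y₁ ≡ b
      φ-y₁ with role y₁
      ... | first y₁≡x₁    = contradiction (sym y₁≡x₁) x₁≢y₁
      ... | second _       = refl
      ... | other _ y₁≢y₁  = contradiction refl y₁≢y₁

      phase₂-copy : RainbowCopyContaining H (addEdges (adjacent , colour) es) (a , b)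
      phase₂-copy = rainbowCopy {H = H} φ φ-injective edges separated (x₁ , y₁ , x₁y₁ , φ-x₁ , φ-y₁)
        where
        edges : ∀ u v → adj H u v ≡ true → stA (φ u) (φ v) ≡ true
        edges u v uv with edge-info uv
        ... | inj₁ (φuv , _)   = addEdges-adj-mono (adjacent , colour) es φuv
        ... | inj₂ (_ , _ , φuv) = φuv

        separated : ∀ {u v u′ v′} → adj H u v ≡ true → adj H u′ v′ ≡ true →
          adjacent (φ u) (φ v) ≡ true → adjacent (φ u′) (φ v′) ≡ false → colour (φ u) (φ v) ≢ stC (φ u′) (φ v′)
        separated uv u′v′ φuv ¬φu′v′ same with edge-info uv | edge-info u′v′
        ... | inj₂ (¬φuv , _) | _                    = not-¬ φuv ¬φuv
        ... | inj₁ _          | inj₁ (φu′v′ , _)     = not-¬ φu′v′ ¬φu′v′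
        ... | inj₁ (_ , fresh-colour) | inj₂ (_ , used-colour , _) = fresh-colour (subst (_∈ used) (sym same) used-colour)

  module _ {k : ℕ} (H : Graph k) (z x : Fin k) (zx : adj H z x ≡ true)
           (deg-fits : deg H z ∸ 1 ≤ t ∸ 1) (order-fits : k + 1 ≤ s ∸ t + deg H z)
           (f : ℕ) (FP : FProp H f) (t+f≤s : t + f ≤ s) (default : Fin f) where

    copy-at : (cs : List ℕ) → length cs ≡ length ordering → Unique cs → (i : Fin (length ordering)) →
      RainbowCopyContaining H (addEdges (adjacent , colour) (take (suc (toℕ i)) (zip ordering cs))) (lookup ordering i)
    copy-at cs length-cs cs-unique i with take-suc-zip ordering cs i (≤-reflexive (sym length-cs))
    ... | c , split rewrite split = in-phase (toℕ i <? length phase₁)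
      where
      pre = take (toℕ i) (zip ordering cs)
      a = proj₁ (lookup ordering i)
      b = proj₂ (lookup ordering i)
      es⊆zip : ∀ {ec} → ec ∈ pre ++ [ ((a , b) , c) ] → ec ∈ zip ordering cs
      es⊆zip ec∈ = ∈-take⁻ (subst (_ ∈_) (sym split) ec∈)
      in-phase : Dec (toℕ i < length phase₁) → RainbowCopyContaining H (addEdges (adjacent , colour) (pre ++ [ ((a , b) , c) ])) (a , b)
      in-phase (yes i<) = AfterAdding.phase₁-copy H cs cs-unique pre a b c es⊆zip z x zx deg-fits order-fits
        (proj₂ (∈-filter⁻ inPhase₁? {xs = pairs} (lookup-++-< phase₁ phase₂ i i<)))
      in-phase (no i≮) with proj₂ (∈-filter⁻ inPhase₂? {xs = pairs} (lookup-++-≥ phase₁ phase₂ i (≮⇒≥ i≮)))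
      ... | s≤a , a<b = AfterAdding.Phase₂.phase₂-copy H cs cs-unique pre a b c es⊆zip f FP t+f≤s default phase₁-added s≤a a<b
        where
        phase₁-added : ∀ {p} → p ∈ phase₁ → ∃[ c′ ] (p , c′) ∈ pre ++ [ ((a , b) , c) ]
        phase₁-added p∈ with ∈-take-zip-++ {xs₂ = phase₂} p∈ (≤-trans (≮⇒≥ i≮) (n≤1+n _))
                               (≤-trans (≤-trans (m≤m+n _ _) (≤-reflexive (sym (length-++ phase₁)))) (≤-reflexive (sym length-cs)))
        ... | c′ , p∈take = c′ , subst (_ ∈_) split p∈take

    weaklyRainbowSaturated : WeaklyRainbowSat H colouredConstruction
    weaklyRainbowSaturated = ordering , ordering-nonEdgeOrdering , copy-at

-- The lower bound

module MinDegree {k n : ℕ} (H : Graph k) (d : ℕ) (δ : IsMinPosDeg H d) (2≤d : 2 ≤ d) (d<n : d < n)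
  (G : ColGraph n) (wrs : WeaklyRainbowSat H G) where

  A₀ : Adj n
  A₀ = adj (graph G)

  C₀ : Col n
  C₀ = col G

  L : List (Fin n × Fin n)
  L = proj₁ wrs

  L-ordering : NonEdgeOrdering (graph G) L
  L-ordering = proj₁ (proj₂ wrs)

  SaturatesAlong : List (Fin n × Fin n) → Set
  SaturatesAlong L′ = (cs : List ℕ) → length cs ≡ length L′ → Unique cs → (i : Fin (length L′)) →
    RainbowCopyContaining H (addEdges (A₀ , C₀) (take (suc (toℕ i)) (zip L′ cs))) (lookup L′ i)

  module _ {pre : List (Fin n × Fin n)} {e : Fin n × Fin n} {post : List (Fin n × Fin n)}
           (L≡ : L ≡ pre ++ e ∷ post) (α : ℕ) where

    earlyColours : List ℕ
    earlyColours = freshColours (suc α) (length pre)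

    copy-through : RainbowCopyContaining H (addEdges (A₀ , C₀) (zip pre earlyColours ++ [ (e , α) ])) e
    copy-through with position-of pre e post
    ... | i , i≡ , lookup≡ =
      subst₂ (λ es e′ → RainbowCopyContaining H (addEdges (A₀ , C₀) es) e′)
        (trans (cong (λ m → take (suc m) (zip (pre ++ e ∷ post) colours)) i≡) (take-zip-++-∷ (length-applyUpTo _ (length pre))))
        lookup≡
        (subst SaturatesAlong L≡ (proj₂ (proj₂ wrs)) colours length-colours (colours-around α (length pre) (length post)) i)
      where
      colours : List ℕ
      colours = earlyColours ++ α ∷ freshColours (suc α + length pre) (length post)
      length-colours : length colours ≡ length (pre ++ e ∷ post)
      length-colours = begin
        length colours                                    ≡⟨ length-++ earlyColours ⟩
        length earlyColours + suc (length (freshColours (suc α + length pre) (length post)))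
          ≡⟨ cong₂ (λ p q → p + suc q) (length-applyUpTo _ (length pre)) (length-applyUpTo _ (length post)) ⟩
        length pre + suc (length post)                    ≡⟨ length-++ pre ⟨
        length (pre ++ e ∷ post)                          ∎
        where open ≡-Reasoning

  Incident : Fin n → Fin n × Fin n → Set
  Incident v (p , q) = p ≡ v ⊎ q ≡ v

  incident? : ∀ v e → Dec (Incident v e)
  incident? v (p , q) = p ≟ v ⊎-dec q ≟ v

  module AtVertex (v : Fin n) (low : deg (graph G) v < d) where

    private
      far : ∃[ w ] (w ≢ v × A₀ v w ≡ false)
      far = non-neighbour (graph G) v (<-≤-trans (s≤s low) d<n)

    incident-nonedge : Any (Incident v) L
    incident-nonedge with far
    ... | w , w≢v , vw with <-cmp (toℕ v) (toℕ w)
    ...   | tri< v<w _ _ = lose (proj₂ (proj₂ L-ordering v w) (v<w , vw)) (inj₁ refl)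
    ...   | tri≈ _ v≡w _ = contradiction (sym (toℕ-injective v≡w)) w≢v
    ...   | tri> _ _ w<v = lose (proj₂ (proj₂ L-ordering w v) (w<v , trans (adj-sym (graph G) w v) vw)) (inj₂ refl)

    opaque
      first-incident : ∃[ pre ] ∃[ e ] ∃[ post ] (L ≡ pre ++ e ∷ post × All (λ y → ¬ Incident v y) pre × Incident v e)
      first-incident = split-at-first (incident? v) incident-nonedge

    pre post : List (Fin n × Fin n)
    pre  = proj₁ first-incident
    post = proj₁ (proj₂ (proj₂ first-incident))

    e : Fin n × Fin n
    e = proj₁ (proj₂ first-incident)

    L≡ : L ≡ pre ++ e ∷ post
    L≡ = proj₁ (proj₂ (proj₂ (proj₂ first-incident)))

    pre-avoids : All (λ y → ¬ Incident v y) pre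
    pre-avoids = proj₁ (proj₂ (proj₂ (proj₂ (proj₂ first-incident))))

    e-nonedge : toℕ (proj₁ e) < toℕ (proj₂ e) × A₀ (proj₁ e) (proj₂ e) ≡ false
    e-nonedge = proj₁ (proj₂ L-ordering (proj₁ e) (proj₂ e)) (subst (e ∈_) (sym L≡) (∈-++⁺ʳ pre (here refl)))

    private
      other-end : ∃[ ω ] SameEdge (proj₁ e) (proj₂ e) v ω
      other-end with proj₂ (proj₂ (proj₂ (proj₂ (proj₂ first-incident))))
      ... | inj₁ e₁≡v = proj₂ e , inj₁ (e₁≡v , refl)
      ... | inj₂ e₂≡v = proj₁ e , inj₂ (refl , e₂≡v)

    ω : Fin n
    ω = proj₁ other-end

    e≈vω : SameEdge (proj₁ e) (proj₂ e) v ω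
    e≈vω = proj₂ other-end

    v≢ω : v ≢ ω
    v≢ω v≡ω with e≈vω
    ... | inj₁ (e₁≡v , e₂≡ω) = <⇒≢ (proj₁ e-nonedge) (cong toℕ (trans e₁≡v (trans v≡ω (sym e₂≡ω))))
    ... | inj₂ (e₁≡ω , e₂≡v) = <⇒≢ (proj₁ e-nonedge) (cong toℕ (trans e₁≡ω (trans (sym v≡ω) (sym e₂≡v))))

    vω-nonedge : A₀ v ω ≡ false
    vω-nonedge with e≈vω
    ... | inj₁ (e₁≡v , e₂≡ω) = subst₂ (λ p q → A₀ p q ≡ false) e₁≡v e₂≡ω (proj₂ e-nonedge)
    ... | inj₂ (e₁≡ω , e₂≡v) = trans (adj-sym (graph G) v ω) (subst₂ (λ p q → A₀ p q ≡ false) e₁≡ω e₂≡v (proj₂ e-nonedge))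

    touches-v : ∀ {p} → samePair e v p ≡ true → p ≡ ω
    touches-v {p} touches with SameEdge-via (samePair⁻ {a = proj₁ e} {proj₂ e} touches) e≈vω
    ... | inj₁ (_ , p≡ω)   = p≡ω
    ... | inj₂ (v≡ω , _)   = contradiction v≡ω v≢ω

    pre-untouched : ∀ {q p} → q ∈ pre → ¬ samePair q v p ≡ true
    pre-untouched {q} q∈ touches with samePair⁻ {a = proj₁ q} {proj₂ q} touches
    ... | inj₁ (q₁≡v , _) = All.lookup pre-avoids q∈ (inj₁ q₁≡v)
    ... | inj₂ (_ , q₂≡v) = All.lookup pre-avoids q∈ (inj₂ q₂≡v)

    module WithColour (α : ℕ) where

      es : List (Entry n)
      es = zip pre (earlyColours L≡ α) ++ [ (e , α) ]

      stA : Adj n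
      stA = proj₁ (addEdges (A₀ , C₀) es)

      stC : Col n
      stC = proj₂ (addEdges (A₀ , C₀) es)

      state-neighbour : ∀ {p} → stA v p ≡ true → A₀ v p ≡ true ⊎ p ≡ ω
      state-neighbour vp with addEdges-adj⁻ (A₀ , C₀) es vp
      ... | inj₁ vp₀ = inj₁ vp₀
      ... | inj₂ touched with find touched
      ...   | ec , ec∈ , touches with ∈-++⁻ (zip pre (earlyColours L≡ α)) ec∈
      ...     | inj₁ ec∈pre       = contradiction touches (pre-untouched (proj₁ (∈-zip⁻ ec∈pre)))
      ...     | inj₂ (here refl)  = inj₂ (touches-v touches)

      base-colour : ∀ {p} → A₀ v p ≡ true → stC v p ≡ C₀ v p
      base-colour {p} vp = addEdges-col-untouched (A₀ , C₀) es (All.tabulate untouched)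
        where
        untouched : ∀ {ec} → ec ∈ es → ¬ Touches ec v p
        untouched ec∈ touches with ∈-++⁻ (zip pre (earlyColours L≡ α)) ec∈
        ... | inj₁ ec∈pre      = pre-untouched (proj₁ (∈-zip⁻ ec∈pre)) touches
        ... | inj₂ (here refl) = not-¬ (subst (λ q → A₀ v q ≡ true) (touches-v touches) vp) vω-nonedge

      new-edge-colour : stC (proj₁ e) (proj₂ e) ≡ α
      new-edge-colour = proj₂ (addEdges-last (A₀ , C₀) (zip pre (earlyColours L≡ α)) (proj₁ e) (proj₂ e) α)

      new-colour : stC v ω ≡ α
      new-colour with e≈vω
      ... | inj₁ (e₁≡v , e₂≡ω) = subst₂ (λ p q → stC p q ≡ α) e₁≡v e₂≡ω new-edge-colour
      ... | inj₂ (e₁≡ω , e₂≡v) = trans (addEdges-col-sym (A₀ , C₀) es (colSym G) v ω)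
                                       (subst₂ (λ p q → stC p q ≡ α) e₁≡ω e₂≡v new-edge-colour)

      opaque
        copy : RainbowCopyContaining H (addEdges (A₀ , C₀) es) e
        copy = copy-through L≡ α

      φ : Fin k → Fin n
      φ = proj₁ copy

      φ-injective : ∀ {u u′} → φ u ≡ φ u′ → u ≡ u′
      φ-injective = proj₁ (proj₂ copy) _ _

      centre : ∃[ u ] ∃[ u′ ] (φ u ≡ v × φ u′ ≡ ω × adj H u u′ ≡ true)
      centre with proj₂ (proj₂ (proj₂ (proj₂ copy))) | e≈vω
      ... | u₀ , v₀ , u₀v₀ , φu₀ , φv₀ | inj₁ (e₁≡v , e₂≡ω) = u₀ , v₀ , trans φu₀ e₁≡v , trans φv₀ e₂≡ω , u₀v₀
      ... | u₀ , v₀ , u₀v₀ , φu₀ , φv₀ | inj₂ (e₁≡ω , e₂≡v) = v₀ , u₀ , trans φv₀ e₂≡v , trans φu₀ e₁≡ω , trans (adj-sym H v₀ u₀) u₀v₀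

      module Centre (u u′ : Fin k) (φu≡v : φ u ≡ v) (φu′≡ω : φ u′ ≡ ω) (uu′ : adj H u u′ ≡ true) where

        neighbours-u : List (Fin k)
        neighbours-u = filterᵇ (adj H u) (allFin k)

        d≤deg-u : d ≤ deg H u
        d≤deg-u = proj₂ (proj₂ δ) u (λ deg≡0 → <⇒≢ (∈-length (∈-neighbours⁺ H uu′)) (sym deg≡0))

        image-near-v : ∀ {h} → h ∈ neighbours-u → φ h ∈ ω ∷ filterᵇ (A₀ v) (allFin n)
        image-near-v {h} h∈ with state-neighbour (subst (λ y → stA y (φ h) ≡ true) φu≡v (proj₁ (proj₂ (proj₂ copy)) u h (∈-neighbours⁻ H h∈)))
        ... | inj₁ vφh  = there (∈-neighbours⁺ (graph G) vφh)
        ... | inj₂ φh≡ω = here φh≡ω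

        isolated-impossible : (∀ q → A₀ v q ≡ false) → ⊥
        isolated-impossible isolated = <⇒≱ 2≤d (≤-trans d≤deg-u
          (length-≤-injectiveOn φ (filter⁺ (T? ∘ adj H u) (allFin⁺ k)) only-ω (λ _ _ → φ-injective)))
          where
          only-ω : ∀ {h} → h ∈ neighbours-u → φ h ∈ ω ∷ []
          only-ω h∈ with image-near-v h∈
          ... | here φh≡ω = here φh≡ω
          ... | there φh∈ = contradiction (∈-neighbours⁻ (graph G) φh∈) (not-¬ (isolated _))

        clash-impossible : ∀ {q} → A₀ v q ≡ true → α ≡ C₀ v q → ⊥
        clash-impossible {q} vq α≡ with any? (λ h → (adj H u h Bool.≟ true) ×-dec (φ h ≟ q))
        ... | yes (h , uh , φh≡q) = proj₁ (proj₂ (proj₂ (proj₂ copy))) u h u u′ uh uu′ distinct (begin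
          stC (φ u) (φ h)   ≡⟨ cong₂ stC φu≡v φh≡q ⟩
          stC v q           ≡⟨ base-colour vq ⟩
          C₀ v q            ≡⟨ α≡ ⟨
          α                 ≡⟨ new-colour ⟨
          stC v ω           ≡⟨ cong₂ stC φu≡v φu′≡ω ⟨
          stC (φ u) (φ u′)  ∎)
          where
          open ≡-Reasoning
          distinct : ¬ SameEdge u h u u′
          distinct (inj₁ (_ , h≡u′)) = not-¬ (subst (λ y → A₀ v y ≡ true) (trans (sym φh≡q) (trans (cong φ h≡u′) φu′≡ω)) vq) vω-nonedge
          distinct (inj₂ (u≡u′ , _)) = not-¬ (subst (λ y → adj H u y ≡ true) (sym u≡u′) uu′) (irrefl H u)
        ... | no missed = <⇒≱ low (≤-trans d≤deg-u (≤-pred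
          (length-<-injectiveOn φ (filter⁺ (T? ∘ adj H u) (allFin⁺ k)) image-near-v (λ _ _ → φ-injective)
            (there (∈-neighbours⁺ (graph G) vq)) (λ {h} h∈ φh≡q → missed (h , ∈-neighbours⁻ H h∈ , φh≡q)))))

      isolated-impossible : (∀ q → A₀ v q ≡ false) → ⊥
      isolated-impossible with centre
      ... | u , u′ , φu≡v , φu′≡ω , uu′ = Centre.isolated-impossible u u′ φu≡v φu′≡ω uu′

      clash-impossible : ∀ {q} → A₀ v q ≡ true → α ≡ C₀ v q → ⊥
      clash-impossible with centre
      ... | u , u′ , φu≡v , φu′≡ω , uu′ = Centre.clash-impossible u u′ φu≡v φu′≡ω uu′

    impossible : ⊥
    impossible with any? (λ q → A₀ v q Bool.≟ true)
    ... | yes (q , vq) = WithColour.clash-impossible (C₀ v q) vq refl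
    ... | no isolated  = WithColour.isolated-impossible 0 (λ q → Bool.¬-not (λ vq → isolated (q , vq)))

  deg-≥ : ∀ v → d ≤ deg (graph G) v
  deg-≥ v = decidable-stable (d ≤? deg (graph G) v) (λ d≰ → AtVertex.impossible v (≰⇒> d≰))

  lower-bound : d * n ≤ 2 * eCount (graph G)
  lower-bound = begin
    d * n                       ≡⟨ *-comm d n ⟩
    n * d                       ≡⟨ ∑-const n d ⟨
    ∑[ v < n ] d                ≤⟨ ∑-mono-≤ deg-≥ ⟩
    ∑[ v < n ] deg (graph G) v  ≡⟨ handshake (graph G) ⟩
    2 * eCount (graph G)        ∎
    where open ≤-Reasoning

IsRwsat-≤ : {H : Graph k} {G : ColGraph n} → WeaklyRainbowSat H G → IsRwsat n H r → r ≤ eCount (graph G)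
IsRwsat-≤ {G = G} saturated (inj₁ (_ , _ , _ , minimal)) = minimal G saturated
IsRwsat-≤ {G = G} saturated (inj₂ (none , _))           = contradiction saturated (none G)

rwsat-≥ : {H : Graph k} {d : ℕ} → IsMinPosDeg H d → 2 ≤ d → d < n →
  {G : ColGraph n} → WeaklyRainbowSat H G → IsRwsat n H r → d * n ≤ 2 * r
rwsat-≥ {n = n} {H = H} {d} δ 2≤d d<n _ (inj₁ (G′ , saturated′ , size , _)) =
  subst (λ e → d * n ≤ 2 * e) size (MinDegree.lower-bound H d δ 2≤d d<n G′ saturated′)
rwsat-≥ _ _ _ {G} saturated (inj₂ (none , _)) = contradiction saturated (none G)

some-neighbour : (G : Graph n) (v : Fin n) → 0 < deg G v → ∃[ w ] adj G v w ≡ true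
some-neighbour G v deg>0 with filterᵇ (adj G v) (allFin _) in eq
... | w ∷ _ = w , ∈-neighbours⁻ G (subst (w ∈_) (sym eq) (here refl))

pendant-vertex : {H : Graph k} → HasPendant H → ∃[ z ] ∃[ x ] (adj H z x ≡ true × deg H z ≡ 1)
pendant-vertex         (u , v , uv , inj₁ deg-u≡1) = u , v , uv , deg-u≡1
pendant-vertex {H = H} (u , v , uv , inj₂ deg-v≡1) = v , u , trans (adj-sym H v u) uv , deg-v≡1

min-degree-vertex : {H : Graph k} {d : ℕ} → IsMinPosDeg H d → ∃[ z ] ∃[ x ] (adj H z x ≡ true × deg H z ≡ d)
min-degree-vertex {H = H} {d} ((z , deg≡d) , d≢0 , _) with some-neighbour H z (subst (0 <_) (sym deg≡d) (n≢0⇒n>0 d≢0))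
... | x , zx = z , x , zx , deg≡d

no-pendant⇒2≤ : {H : Graph k} {d : ℕ} → ¬ HasPendant H → IsMinPosDeg H d → 2 ≤ d
no-pendant⇒2≤ {d = zero}        _          (_ , d≢0 , _) = contradiction refl d≢0
no-pendant⇒2≤ {H = H} {suc zero} no-pendant δ with min-degree-vertex {H = H} δ
... | z , x , zx , deg≡1 = contradiction (z , x , zx , inj₁ deg≡1) no-pendant
no-pendant⇒2≤ {d = suc (suc _)} _          _             = s≤s (s≤s z≤n)

construction-saturates : {H : Graph k} {f : ℕ} → FProp H f → ∀ s t {z x} → adj H z x ≡ true →
  deg H z ∸ 1 ≤ t ∸ 1 → k + 1 ≤ s ∸ t + deg H z → t + f ≤ s → s < n →
  Σ[ G ∈ ColGraph n ] (WeaklyRainbowSat H G × eCount (graph G) ≤ s C 2 + t * (n ∸ s))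
construction-saturates {n = suc n} {H = H} {f} FP s t {z} {x} zx deg-fits order-fits t+f≤s s<n =
  colouredConstruction , weaklyRainbowSaturated H z x zx deg-fits order-fits f FP t+f≤s default , eCount-construction
  where
  open Construction (suc n) s t (m+n≤o⇒m≤o t t+f≤s) (<⇒≤ s<n)
  default : Fin f
  default = fromℕ< (≤-trans (s≤s z≤n) (FProp⇒2≤ {H = H} FP))

theorem3p1 : ∀ {k} (H : Graph k) → HasEdge H → (f : ℕ) → IsF H f →
    ((HasPendant H → ∀ n r → f + 1 < n → IsRwsat n H r → r ≤ (f + 1) C 2)
    × (¬ HasPendant H → ∀ d → IsMinPosDeg H d → ∀ n r → f + d < n → IsRwsat n H r →
        (d * n ≤ 2 * r × r ≤ d * (n ∸ f ∸ d) + (f + d) C 2)))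
-- Neither HasEdge H nor the minimality of f is needed: each case finds its own edge of H, and
-- only the defining property of f is used.
theorem3p1 {k} H _ f (FP , _) = pendant-case , no-pendant-case
  where
  k≤f+1 : k ≤ f + 1
  k≤f+1 = FProp⇒order≤ {H = H} FP

  pendant-case : HasPendant H → ∀ n r → f + 1 < n → IsRwsat n H r → r ≤ (f + 1) C 2
  pendant-case pendant n r f+1<n rwsat with pendant-vertex {H = H} pendant
  ... | z , x , zx , deg≡1 with construction-saturates {H = H} FP (f + 1) 0 zx
          (subst (λ e → e ∸ 1 ≤ 0) (sym deg≡1) z≤n)
          (subst (λ e → k + 1 ≤ f + 1 + e) (sym deg≡1) (+-monoˡ-≤ 1 k≤f+1)) (m≤m+n f 1) f+1<n
  ...   | G , saturated , size = ≤-trans (IsRwsat-≤ {H = H} {G = G} saturated rwsat) (≤-trans size (≤-reflexive (+-identityʳ _)))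

  no-pendant-case : ¬ HasPendant H → ∀ d → IsMinPosDeg H d → ∀ n r → f + d < n → IsRwsat n H r →
    (d * n ≤ 2 * r × r ≤ d * (n ∸ f ∸ d) + (f + d) C 2)
  no-pendant-case no-pendant d δ n r f+d<n rwsat with min-degree-vertex {H = H} δ | no-pendant⇒2≤ {H = H} no-pendant δ
  ... | z , x , zx , deg≡d | 2≤d with construction-saturates {H = H} FP (f + d) d zx (≤-reflexive (cong (_∸ 1) deg≡d))
          (subst₂ (λ s∸t e → k + 1 ≤ s∸t + e) (sym (m+n∸n≡m f d)) (sym deg≡d)
            (≤-trans (+-monoˡ-≤ 1 k≤f+1) (≤-trans (≤-reflexive (+-assoc f 1 1)) (+-monoʳ-≤ f 2≤d))))
          (≤-reflexive (+-comm d f)) f+d<n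
  ...   | G , saturated , size =
    rwsat-≥ {H = H} δ 2≤d (≤-<-trans (m≤n+m d f) f+d<n) {G} saturated rwsat ,
    ≤-trans (IsRwsat-≤ {H = H} {G = G} saturated rwsat)
      (≤-trans size (≤-reflexive (trans (+-comm ((f + d) C 2) _) (cong (λ m → d * m + (f + d) C 2) (sym (∸-+-assoc n f d))))))
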